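{- Let $\ell\ge 7$ be odd. There is an $\ell$-cycle decomposition of $C_3[\ell]$ together with a $2$-colouring (red/blue) of its vertices which is equitable for the decomposition and in which each part $\{x\}\times V(\overline{K_\ell})$ has $(\ell+1)/2$ red and $(\ell-1)/2$ blue vertices.
   Context: For a graph $G$ and integer $n$, $G[n]$ is the lexicographic product of $G$ with the empty graph $\overline{K_n}$: vertex set $V(G)\times\{1,\dots,n\}$, with $(g,h)$ adjacent to $(g',h')$ iff $gg'\in E(G)$. Its parts are the sets $\{g\}\times\{1,\dots,n\}$. $C_3$ is the $3$-cycle. An $\ell$-cycle decomposition is a set of $\ell$-cycles whose edge sets partition the edge set; a $2$-colouring is equitable if each cycle has $(\ell-1)/2$ or $(\ell+1)/2$ vertices of each colour. -}

module Defs where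

open import Data.Nat using (ℕ; zero; suc; _<?_; _+_)
open import Data.Fin using (Fin; zero; suc; toℕ; fromℕ<)
open import Data.Bool using (Bool; true; false)
open import Data.Product using (_×_; _,_; Σ; ∃)
open import Data.Sum using (_⊎_)
open import Relation.Binary.PropositionalEquality using (_≡_)
open import Relation.Nullary using (¬_; yes; no)
open import Function.Definitions using (Injective)

-- Vertices of C₃[ℓ] : V(C₃) × {1..ℓ}, with V(C₃) = Fin 3 and {1..ℓ} = Fin ℓ.
Vtx : ℕ → Set
Vtx ℓ = Fin 3 × Fin ℓ

-- (g,h) ~ (g',h') iff gg' ∈ E(C₃), i.e. g ≠ g' (C₃ = K₃ on Fin 3).
Adj : ∀ {ℓ} → Vtx ℓ → Vtx ℓ → Set
Adj (g , _) (g' , _) = ¬ (g ≡ g')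

next : ∀ {n} → Fin n → Fin n
next {suc n} i with suc (toℕ i) <? suc n
... | yes p = fromℕ< p
... | no _  = zero

record Cycle (ℓ n : ℕ) : Set where
  field
    vtx  : Fin ℓ → Vtx n
    inj  : Injective _≡_ _≡_ vtx
    adj  : ∀ i → Adj (vtx i) (vtx (next i))
open Cycle public

EdgeAt : ∀ {ℓ n} → Cycle ℓ n → Fin ℓ → Vtx n → Vtx n → Set
EdgeAt C i u v =
  (vtx C i ≡ u × vtx C (next i) ≡ v) ⊎ (vtx C i ≡ v × vtx C (next i) ≡ u)

IsDecomposition : ∀ {ℓ n m} → (Fin m → Cycle ℓ n) → Set
IsDecomposition {ℓ} {n} {m} cs =
  ∀ (u v : Vtx n) → Adj u v →
    Σ (Fin m × Fin ℓ) λ { (k , i) → EdgeAt (cs k) i u v ×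
      (∀ k' i' → EdgeAt (cs k') i' u v → (k' ≡ k × i' ≡ i)) }

count : ∀ {n} → Bool → (Fin n → Bool) → ℕ
count {zero}  b f = 0
count {suc n} b f with f zero | b
... | true  | true  = suc (count b (λ i → f (suc i)))
... | false | false = suc (count b (λ i → f (suc i)))
... | true  | false = count b (λ i → f (suc i))
... | false | true  = count b (λ i → f (suc i))

module Submission where

-- Write ℓ = 2n + 1 and N = 2n, and label the vertices of each part by ℤ_N ∪ {∞}.
-- A closed walk of length ℓ on the labels whose steps are marked up or down lifts,
-- for each s ∈ ℤ/3, to a closed walk in C₃[ℓ] that starts in part s and moves to the
-- next or previous part at each step. Reading every edge from its lower part g to its
-- upper part g + 1, a family of ℓ walks with injective lifts yields a decomposition of
-- C₃[ℓ] into 3ℓ cycles as soon as every ordered pair of labels is traversed by exactly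
-- one arc of the family.
-- The walks are the translates by j ∈ ℤ_N of ∞, 1, −1, 2, 2, −2, 3, −3, …, n − 1, 1 − n, n,
-- whose arcs realise every difference of labels once except one of ±1, and a spine
-- 0, 0, 1, 2, …, N − 1 that collects the remaining arcs of difference ±1; the translate
-- by N − 2 trades its loop at 0, which the spine needs, for the loop at ∞.
-- As N is even, colouring a label red iff it is even (∞ included) is invariant under
-- translation. Every part then has n + 1 red vertices, and so does every cycle: its finite
-- labels come in pairs j ± a of equal colour, alternating with a.

open import Defs
open import Data.Bool using (Bool; true; false; not; if_then_else_; _∨_; T)
open import Data.Bool.Properties using (∨-zeroʳ; ∨-identityʳ)
open import Data.Empty using (⊥-elim)
open import Data.Fin using (Fin; zero; suc; toℕ; fromℕ<; combine; remQuot) renaming (_≟_ to _≟ᶠ_)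
open import Data.Fin.Properties using (all?; remQuot-combine; combine-remQuot; toℕ-fromℕ<; toℕ-injective; toℕ<n)
open import Data.Nat using (ℕ; zero; suc; pred; _+_; _*_; _∸_; _%_; _/_; _≤_; _<_; s≤s; z≤n; NonZero; ⌊_/2⌋; _≡ᵇ_; _≤ᵇ_; _<?_)
open import Data.Nat.DivMod
open import Data.Nat.Properties
open import Data.Nat.Tactic.RingSolver using (solve-∀)
open import Data.Product using (_×_; _,_; proj₁; proj₂; Σ; uncurry)
open import Data.Product.Properties using (,-injectiveˡ; ,-injectiveʳ)
open import Data.Sum using (_⊎_; inj₁; inj₂)
open import Function.Definitions using (Injective)
open import Relation.Binary.PropositionalEquality using (_≡_; _≢_; refl; sym; trans; cong; cong₂; subst; module ≡-Reasoning)
open import Relation.Nullary using (¬_; yes; no)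
open import Relation.Nullary.Decidable using (toWitness; _→-dec_; _⊎-dec_; ¬?)

infixl 6 _⊕_ _⊖_

_⊕_ : Fin 3 → Fin 3 → Fin 3
a ⊕ b = fromℕ< (m%n<n (toℕ a + toℕ b) 3)

_⊖_ : Fin 3 → Fin 3 → Fin 3
a ⊖ b = fromℕ< (m%n<n (toℕ a + (3 ∸ toℕ b)) 3)

0₃ 1₃ 2₃ : Fin 3
0₃ = zero
1₃ = suc zero
2₃ = suc (suc zero)

step : Bool → Fin 3
step true  = 1₃
step false = 2₃

⊕-assoc : ∀ a b c → a ⊕ b ⊕ c ≡ a ⊕ (b ⊕ c)
⊕-assoc = toWitness {a? = all? λ a → all? λ b → all? λ c → a ⊕ b ⊕ c ≟ᶠ a ⊕ (b ⊕ c)} _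

⊕-cancelˡ : ∀ s a b → s ⊕ a ≡ s ⊕ b → a ≡ b
⊕-cancelˡ = toWitness {a? = all? λ s → all? λ a → all? λ b → (s ⊕ a ≟ᶠ s ⊕ b) →-dec (a ≟ᶠ b)} _

⊖-⊕ : ∀ a b → a ⊖ b ⊕ b ≡ a
⊖-⊕ = toWitness {a? = all? λ a → all? λ b → a ⊖ b ⊕ b ≟ᶠ a} _

⊕-⊖ : ∀ a b → a ⊕ b ⊖ b ≡ a
⊕-⊖ = toWitness {a? = all? λ a → all? λ b → a ⊕ b ⊖ b ≟ᶠ a} _

⊕1-irreflexive : ∀ a → a ≢ a ⊕ 1₃
⊕1-irreflexive = toWitness {a? = all? λ a → ¬? (a ≟ᶠ a ⊕ 1₃)} _

⊕2-irreflexive : ∀ a → a ≢ a ⊕ 2₃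
⊕2-irreflexive = toWitness {a? = all? λ a → ¬? (a ≟ᶠ a ⊕ 2₃)} _

⊕1⊕1-irreflexive : ∀ a → a ⊕ 1₃ ⊕ 1₃ ≢ a
⊕1⊕1-irreflexive = toWitness {a? = all? λ a → ¬? (a ⊕ 1₃ ⊕ 1₃ ≟ᶠ a)} _

⊕2⊕1 : ∀ a → a ⊕ 2₃ ⊕ 1₃ ≡ a
⊕2⊕1 = toWitness {a? = all? λ a → a ⊕ 2₃ ⊕ 1₃ ≟ᶠ a} _

≢⇒⊕1 : ∀ g h → g ≢ h → h ≡ g ⊕ 1₃ ⊎ g ≡ h ⊕ 1₃
≢⇒⊕1 = toWitness {a? = all? λ g → all? λ h → ¬? (g ≟ᶠ h) →-dec (h ≟ᶠ g ⊕ 1₃ ⊎-dec g ≟ᶠ h ⊕ 1₃)} _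

module Translation (N : ℕ) .{{_ : NonZero N}} where

  infixl 6 _⊞_ _⊟_

  _⊞_ : ℕ → ℕ → ℕ
  x ⊞ a = (x + a) % N

  -- Subtraction modulo N, for a ≤ N only: otherwise N ∸ a truncates to 0.
  _⊟_ : ℕ → ℕ → ℕ
  x ⊟ a = x ⊞ (N ∸ a)

  ⊞-< : ∀ x a → x ⊞ a < N
  ⊞-< x a = m%n<n (x + a) N

  ⊞-≤ : ∀ x a → x ⊞ a ≤ N
  ⊞-≤ x a = <⇒≤ (⊞-< x a)

  %-absorbˡ : ∀ x a → x % N ⊞ a ≡ x ⊞ a
  %-absorbˡ x a = begin
    (x % N + a) % N         ≡⟨ %-distribˡ-+ (x % N) a N ⟩
    (x % N % N + a % N) % N ≡⟨ cong (λ z → (z + a % N) % N) (m%n%n≡m%n x N) ⟩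
    (x % N + a % N) % N     ≡⟨ %-distribˡ-+ x a N ⟨
    (x + a) % N             ∎
    where open ≡-Reasoning

  %-absorbʳ : ∀ x a → x ⊞ a % N ≡ x ⊞ a
  %-absorbʳ x a = trans (cong (_% N) (+-comm x (a % N))) (trans (%-absorbˡ a x) (cong (_% N) (+-comm a x)))

  ⊞-⊞ : ∀ x a b → x ⊞ a ⊞ b ≡ x ⊞ (a + b)
  ⊞-⊞ x a b = trans (%-absorbˡ (x + a) b) (cong (_% N) (+-assoc x a b))

  ⊞-N : ∀ x → x ⊞ N ≡ x % N
  ⊞-N x = [m+n]%n≡m%n x N

  ⊞-0 : ∀ {x} → x < N → x ⊞ 0 ≡ x
  ⊞-0 {x} x<N = trans (cong (_% N) (+-identityʳ x)) (m<n⇒m%n≡m x<N)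

  ⊟-⊞ : ∀ x {a} → a ≤ N → x ⊟ a ⊞ a ≡ x % N
  ⊟-⊞ x {a} a≤N = trans (⊞-⊞ x (N ∸ a) a) (trans (cong (x ⊞_) (m∸n+n≡m a≤N)) (⊞-N x))

  ⊞-⊟ : ∀ x {a} → a ≤ N → x ⊞ a ⊟ a ≡ x % N
  ⊞-⊟ x {a} a≤N = trans (⊞-⊞ x a (N ∸ a)) (trans (cong (x ⊞_) (m+[n∸m]≡n a≤N)) (⊞-N x))

  ⊞-⊟-cancel : ∀ {x} a → x < N → a ≤ N → x ⊞ a ⊟ a ≡ x
  ⊞-⊟-cancel {x} a x<N a≤N = trans (⊞-⊟ x a≤N) (m<n⇒m%n≡m x<N)

  ⊟-⊞-cancel : ∀ {x} a → x < N → a ≤ N → x ⊟ a ⊞ a ≡ x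
  ⊟-⊞-cancel {x} a x<N a≤N = trans (⊟-⊞ x a≤N) (m<n⇒m%n≡m x<N)

  ⊞-cancelʳ : ∀ {u v} b → u < N → v < N → b ≤ N → u ⊞ b ≡ v ⊞ b → u ≡ v
  ⊞-cancelʳ {u} {v} b u<N v<N b≤N e = begin
    u           ≡⟨ m<n⇒m%n≡m u<N ⟨
    u % N       ≡⟨ ⊞-⊟ u b≤N ⟨
    u ⊞ b ⊟ b   ≡⟨ cong (_⊟ b) e ⟩
    v ⊞ b ⊟ b   ≡⟨ ⊞-⊟ v b≤N ⟩
    v % N       ≡⟨ m<n⇒m%n≡m v<N ⟩
    v           ∎
    where open ≡-Reasoning

  ⊟-translate : ∀ j a {b} → b ≤ N → (j ⊞ a) ⊟ (j ⊞ b) ≡ a ⊟ b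
  ⊟-translate j a {b} b≤N = ⊞-cancelʳ (j ⊞ b) (⊞-< (j ⊞ a) (N ∸ (j ⊞ b))) (⊞-< a (N ∸ b)) (⊞-≤ j b) (begin
    (j ⊞ a) ⊟ (j ⊞ b) ⊞ (j ⊞ b)  ≡⟨ ⊟-⊞ (j ⊞ a) (⊞-≤ j b) ⟩
    (j + a) % N % N              ≡⟨ m%n%n≡m%n (j + a) N ⟩
    j ⊞ a                        ≡⟨ ⊞-N (j + a) ⟨
    (j + a + N) % N              ≡⟨ cong (_% N) (sum≡) ⟨
    (a + (N ∸ b) + (j + b)) % N  ≡⟨ %-absorbˡ (a + (N ∸ b)) (j + b) ⟨
    a ⊟ b ⊞ (j + b)              ≡⟨ %-absorbʳ (a ⊟ b) (j + b) ⟨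
    a ⊟ b ⊞ (j ⊞ b)              ∎)
    where
    open ≡-Reasoning
    sum≡ : a + (N ∸ b) + (j + b) ≡ j + a + N
    sum≡ = begin
      a + (N ∸ b) + (j + b)  ≡⟨ cong (a + (N ∸ b) +_) (+-comm j b) ⟩
      a + (N ∸ b) + (b + j)  ≡⟨ +-assoc a (N ∸ b) (b + j) ⟩
      a + ((N ∸ b) + (b + j)) ≡⟨ cong (a +_) (+-assoc (N ∸ b) b j) ⟨
      a + ((N ∸ b) + b + j)  ≡⟨ cong (λ z → a + (z + j)) (m∸n+n≡m b≤N) ⟩
      a + (N + j)            ≡⟨ cong (a +_) (+-comm N j) ⟩
      a + (j + N)            ≡⟨ +-assoc a j N ⟨
      a + j + N              ≡⟨ cong (_+ N) (+-comm a j) ⟩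
      j + a + N              ∎

  ⊞-⊟-offset : ∀ {j a} → j < N → a < N → j ⊞ a ⊟ j ≡ a
  ⊞-⊟-offset {j} {a} j<N a<N = begin
    j ⊞ a ⊟ j            ≡⟨ cong (j ⊞ a ⊟_) (⊞-0 j<N) ⟨
    j ⊞ a ⊟ (j ⊞ 0)      ≡⟨ ⊟-translate j a z≤n ⟩
    a ⊞ N                ≡⟨ ⊞-N a ⟩
    a % N                ≡⟨ m<n⇒m%n≡m a<N ⟩
    a                    ∎
    where open ≡-Reasoning

  ⊟-⊟ : ∀ x a b → a + b ≤ N → x ⊟ a ⊟ b ≡ x ⊟ (a + b)
  ⊟-⊟ x a b a+b≤N = begin
    x ⊟ a ⊟ b                   ≡⟨ ⊞-⊞ x (N ∸ a) (N ∸ b) ⟩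
    x ⊞ ((N ∸ a) + (N ∸ b))     ≡⟨ cong (x ⊞_) sum≡ ⟩
    x ⊞ ((N ∸ (a + b)) + N)     ≡⟨ ⊞-⊞ x (N ∸ (a + b)) N ⟨
    x ⊟ (a + b) ⊞ N             ≡⟨ ⊞-N (x ⊟ (a + b)) ⟩
    (x ⊟ (a + b)) % N           ≡⟨ m%n%n≡m%n (x + (N ∸ (a + b))) N ⟩
    x ⊟ (a + b)                 ∎
    where
    open ≡-Reasoning
    b≤N∸a : b ≤ N ∸ a
    b≤N∸a = subst (_≤ N ∸ a) (m+n∸m≡n a b) (∸-monoˡ-≤ a a+b≤N)
    sum≡ : (N ∸ a) + (N ∸ b) ≡ (N ∸ (a + b)) + N
    sum≡ = begin
      (N ∸ a) + (N ∸ b)            ≡⟨ cong (_+ (N ∸ b)) (m∸n+n≡m b≤N∸a) ⟨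
      (N ∸ a ∸ b) + b + (N ∸ b)    ≡⟨ +-assoc (N ∸ a ∸ b) b (N ∸ b) ⟩
      (N ∸ a ∸ b) + (b + (N ∸ b))  ≡⟨ cong₂ _+_ (∸-+-assoc N a b) (m+[n∸m]≡n (≤-trans (m≤n+m b a) a+b≤N)) ⟩
      (N ∸ (a + b)) + N            ∎

  ⊟-self : ∀ {x} → x ≤ N → x ⊟ x ≡ 0
  ⊟-self {x} x≤N = trans (cong (_% N) (m+[n∸m]≡n x≤N)) (n%n≡0 N)

  ⊟≡0⇒≡ : ∀ {x y} → x < N → y < N → x ⊟ y ≡ 0 → x ≡ y
  ⊟≡0⇒≡ {x} {y} x<N y<N e = trans (sym (⊟-⊞-cancel y x<N (<⇒≤ y<N))) (trans (cong (_⊞ y) e) (m<n⇒m%n≡m y<N))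

  ⊟-⊟-self : ∀ {x y} → x < N → y < N → x ⊟ (x ⊟ y) ≡ y
  ⊟-⊟-self {x} {y} x<N y<N = begin
    x ⊟ d              ≡⟨ cong (_⊟ d) (trans (sym (m<n⇒m%n≡m x<N)) (sym (⊟-⊞ x (<⇒≤ y<N)))) ⟩
    (d + y) % N ⊟ d    ≡⟨ cong (λ z → z % N ⊟ d) (+-comm d y) ⟩
    y ⊞ d ⊟ d          ≡⟨ ⊞-⊟ y (⊞-≤ x (N ∸ y)) ⟩
    y % N              ≡⟨ m<n⇒m%n≡m y<N ⟩
    y                  ∎
    where
    open ≡-Reasoning
    d = x ⊟ y

odd : ℕ → Bool
odd 0 = false
odd 1 = true
odd (suc (suc m)) = odd m

odd-suc : ∀ m → odd (suc m) ≡ not (odd m)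
odd-suc 0 = refl
odd-suc 1 = refl
odd-suc (suc (suc m)) = odd-suc m

odd-double : ∀ r → odd (r + r) ≡ false
odd-double zero = refl
odd-double (suc r) rewrite +-suc r r = odd-double r

odd-1+double : ∀ r → odd (suc (r + r)) ≡ true
odd-1+double r = trans (odd-suc (r + r)) (cong not (odd-double r))

odd-+-double : ∀ m q → odd (m + (q + q)) ≡ odd m
odd-+-double m zero = cong odd (+-identityʳ m)
odd-+-double m (suc q) rewrite +-suc q q | +-suc m (suc (q + q)) | +-suc m (q + q) = odd-+-double m q

odd-%-even : ∀ a {N M} .{{_ : NonZero N}} → N ≡ M + M → odd (a % N) ≡ odd a
odd-%-even a {N} {M} N≡M+M = begin
  odd (a % N)                                 ≡⟨ odd-+-double (a % N) (a / N * M) ⟨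
  odd (a % N + (a / N * M + a / N * M))       ≡⟨ cong (λ z → odd (a % N + z)) (*-distribˡ-+ (a / N) M M) ⟨
  odd (a % N + a / N * (M + M))               ≡⟨ cong (λ z → odd (a % N + a / N * z)) N≡M+M ⟨
  odd (a % N + a / N * N)                     ≡⟨ cong odd (m≡m%n+[m/n]*n a N) ⟨
  odd a                                       ∎
  where open ≡-Reasoning

odd-∸-even : ∀ j {b N M} → b ≤ N → N ≡ M + M → odd (j + (N ∸ b)) ≡ odd (j + b)
odd-∸-even j {b} {N} {M} b≤N N≡M+M = begin
  odd (j + (N ∸ b))                ≡⟨ odd-+-double (j + (N ∸ b)) b ⟨
  odd (j + (N ∸ b) + (b + b))      ≡⟨ cong odd sum≡ ⟩
  odd (j + b + (M + M))            ≡⟨ odd-+-double (j + b) M ⟩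
  odd (j + b)                      ∎
  where
  open ≡-Reasoning
  sum≡ : j + (N ∸ b) + (b + b) ≡ j + b + (M + M)
  sum≡ = begin
    j + (N ∸ b) + (b + b)   ≡⟨ +-assoc j (N ∸ b) (b + b) ⟩
    j + ((N ∸ b) + (b + b)) ≡⟨ cong (j +_) (+-assoc (N ∸ b) b b) ⟨
    j + ((N ∸ b) + b + b)   ≡⟨ cong (λ z → j + (z + b)) (m∸n+n≡m b≤N) ⟩
    j + (N + b)             ≡⟨ cong (j +_) (+-comm N b) ⟩
    j + (b + N)             ≡⟨ +-assoc j b N ⟨
    j + b + N               ≡⟨ cong (j + b +_) N≡M+M ⟩
    j + b + (M + M)         ∎

⌊double/2⌋ : ∀ r → ⌊ r + r /2⌋ ≡ r
⌊double/2⌋ r = sym (n≡⌊n+n/2⌋ r)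

⌊1+double/2⌋ : ∀ r → ⌊ suc (r + r) /2⌋ ≡ r
⌊1+double/2⌋ zero = refl
⌊1+double/2⌋ (suc r) rewrite +-suc r r = cong suc (⌊1+double/2⌋ r)

data Halving : ℕ → Set where
  twice   : ∀ r → Halving (r + r)
  twice+1 : ∀ r → Halving (suc (r + r))

halving : ∀ p → Halving p
halving zero = twice 0
halving (suc zero) = twice+1 0
halving (suc (suc p)) with halving p
... | twice r   = subst Halving (cong suc (+-suc r r)) (twice (suc r))
... | twice+1 r = subst Halving (cong (2 +_) (+-suc r r)) (twice+1 (suc r))

double-≤ : ∀ {r s} → r + r ≤ suc (s + s) → r ≤ s
double-≤ {r} {s} le with ≤-<-connex r s
... | inj₁ r≤s = r≤s
... | inj₂ s<r = ⊥-elim (<⇒≱ (subst (_≤ r + r) (cong suc (+-suc s s)) (+-mono-≤ s<r s<r)) le)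

1+double-≤ : ∀ {r s} → suc (r + r) ≤ s + s → r < s
1+double-≤ {r} {s} le = ≰⇒> λ s≤r → <⇒≱ le (+-mono-≤ s≤r s≤r)

≡ᵇ-refl : ∀ m → (m ≡ᵇ m) ≡ true
≡ᵇ-refl zero = refl
≡ᵇ-refl (suc m) = ≡ᵇ-refl m

≢⇒≡ᵇ-false : ∀ {m n} → m ≢ n → (m ≡ᵇ n) ≡ false
≢⇒≡ᵇ-false {m} {n} m≢n with m ≡ᵇ n in eq
... | true  = ⊥-elim (m≢n (≡ᵇ⇒≡ m n (subst T (sym eq) _)))
... | false = refl

≡ᵇ-false⇒≢ : ∀ {m n} → (m ≡ᵇ n) ≡ false → m ≢ n
≡ᵇ-false⇒≢ {m} e refl with () ← trans (sym (≡ᵇ-refl m)) e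

≤⇒≤ᵇ≡true : ∀ {m n} → m ≤ n → (m ≤ᵇ n) ≡ true
≤⇒≤ᵇ≡true {m} {n} m≤n with m ≤ᵇ n in eq
... | true  = refl
... | false = ⊥-elim (subst T eq (≤⇒≤ᵇ m≤n))

>⇒≤ᵇ≡false : ∀ {m n} → n < m → (m ≤ᵇ n) ≡ false
>⇒≤ᵇ≡false {m} {n} n<m with m ≤ᵇ n in eq
... | false = refl
... | true  = ⊥-elim (<⇒≱ n<m (≤ᵇ⇒≤ m n (subst T (sym eq) _)))

≡ᵇ-true⇒≡ : ∀ {m n} → (m ≡ᵇ n) ≡ true → m ≡ n
≡ᵇ-true⇒≡ {m} {n} eq = ≡ᵇ⇒≡ m n (subst T (sym eq) _)

⟦_⟧ : Bool → ℕ
⟦ b ⟧ = if b then 1 else 0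

countℕ : (ℕ → Bool) → ℕ → ℕ
countℕ f zero = 0
countℕ f (suc m) = ⟦ f 0 ⟧ + countℕ (λ i → f (suc i)) m

count-toℕ : ∀ m f → count true (λ (i : Fin m) → f (toℕ i)) ≡ countℕ f m
count-toℕ zero f = refl
count-toℕ (suc m) f with f 0
... | true  = cong suc (count-toℕ m (λ i → f (suc i)))
... | false = count-toℕ m (λ i → f (suc i))

count-cong : ∀ {m} b (f h : Fin m → Bool) → (∀ i → f i ≡ h i) → count b f ≡ count b h
count-cong {zero} b f h eq = refl
count-cong {suc m} b f h eq with f zero | h zero | eq zero | b
... | true  | .true  | refl | true  = cong suc (count-cong true _ _ (λ i → eq (suc i)))
... | true  | .true  | refl | false = count-cong false _ _ (λ i → eq (suc i))
... | false | .false | refl | true  = count-cong true _ _ (λ i → eq (suc i))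
... | false | .false | refl | false = cong suc (count-cong false _ _ (λ i → eq (suc i)))

count-true+false : ∀ {m} (f : Fin m → Bool) → count true f + count false f ≡ m
count-true+false {zero} f = refl
count-true+false {suc m} f with f zero
... | true  = cong suc (count-true+false (λ i → f (suc i)))
... | false = trans (+-suc (count true (λ i → f (suc i))) _) (cong suc (count-true+false (λ i → f (suc i))))

countℕ-cong : ∀ {f g} m → (∀ i → i < m → f i ≡ g i) → countℕ f m ≡ countℕ g m
countℕ-cong zero eq = refl
countℕ-cong (suc m) eq = cong₂ _+_ (cong ⟦_⟧ (eq 0 (s≤s z≤n))) (countℕ-cong m (λ i i<m → eq (suc i) (s≤s i<m)))

countℕ-alternating : ∀ R (E : ℕ → Bool) → (∀ i → E (suc i) ≡ not (E i)) → ∀ i₀ →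
  countℕ (λ q → E (i₀ + ⌊ q /2⌋)) (suc (R + R)) ≡ R + ⟦ E i₀ ⟧
countℕ-alternating zero E alt i₀ = trans (+-identityʳ _) (cong (λ z → ⟦ E z ⟧) (+-identityʳ i₀))
countℕ-alternating (suc R) E alt i₀ rewrite +-suc R R = begin
  ⟦ E (i₀ + 0) ⟧ + (⟦ E (i₀ + 0) ⟧ + countℕ (λ q → E (i₀ + suc ⌊ q /2⌋)) (suc (R + R)))
    ≡⟨ cong₂ (λ a b → ⟦ E a ⟧ + (⟦ E a ⟧ + b)) (+-identityʳ i₀) (countℕ-cong (suc (R + R)) (λ q _ → cong E (+-suc i₀ ⌊ q /2⌋))) ⟩
  ⟦ E i₀ ⟧ + (⟦ E i₀ ⟧ + countℕ (λ q → E (suc i₀ + ⌊ q /2⌋)) (suc (R + R)))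
    ≡⟨ cong (λ z → ⟦ E i₀ ⟧ + (⟦ E i₀ ⟧ + z)) (countℕ-alternating R E alt (suc i₀)) ⟩
  ⟦ E i₀ ⟧ + (⟦ E i₀ ⟧ + (R + ⟦ E (suc i₀) ⟧))
    ≡⟨ cong (λ b → ⟦ E i₀ ⟧ + (⟦ E i₀ ⟧ + (R + ⟦ b ⟧))) (alt i₀) ⟩
  ⟦ E i₀ ⟧ + (⟦ E i₀ ⟧ + (R + ⟦ not (E i₀) ⟧))
    ≡⟨ pair (E i₀) ⟩
  suc R + ⟦ E i₀ ⟧ ∎
  where
  open ≡-Reasoning
  pair : ∀ b → ⟦ b ⟧ + (⟦ b ⟧ + (R + ⟦ not b ⟧)) ≡ suc R + ⟦ b ⟧
  pair true  = cong suc (trans (cong suc (+-identityʳ R)) (+-comm 1 R))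
  pair false = trans (+-comm R 1) (cong suc (sym (+-identityʳ R)))

countℕ-even : ∀ R → countℕ (λ i → not (odd i)) (R + R) ≡ R
countℕ-even zero = refl
countℕ-even (suc R) rewrite +-suc R R = cong suc (countℕ-even R)

countℕ-even-suc : ∀ R → countℕ (λ i → not (odd (suc i))) (R + R) ≡ R
countℕ-even-suc zero = refl
countℕ-even-suc (suc R) rewrite +-suc R R = cong suc (countℕ-even-suc R)

-- Walk J moves between positions p and next p from part shift J p up or down by one;
-- arc (J , p) lists the labels at the lower and the upper end of that step.
record WalkFamily (m ℓ n : ℕ) : Set where
  field
    label : Fin m → Fin ℓ → Fin n
    shift : Fin m → Fin ℓ → Fin 3
    up    : Fin m → Fin ℓ → Bool

  tail head : Fin m → Fin ℓ → Fin ℓ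
  tail J p = if up J p then p else next p
  head J p = if up J p then next p else p

  arc : Fin m × Fin ℓ → Fin n × Fin n
  arc (J , p) = label J (tail J p) , label J (head J p)

record IsDecomposing {m ℓ n} (W : WalkFamily m ℓ n) : Set where
  open WalkFamily W
  field
    shift-next     : ∀ J p → shift J (next p) ≡ shift J p ⊕ step (up J p)
    lift-injective : ∀ J → Injective _≡_ _≡_ (λ p → shift J p , label J p)
    arcIndex       : Fin n × Fin n → Fin m × Fin ℓ
    arcIndex-arc   : ∀ i → arcIndex (arc i) ≡ i
    arc-arcIndex   : ∀ e → arc (arcIndex e) ≡ e

module Lift {m ℓ n} (W : WalkFamily m ℓ n) (D : IsDecomposing W) where
  open WalkFamily W
  open IsDecomposing D

  lifted : Fin 3 → Fin m → Fin ℓ → Vtx n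
  lifted s J p = s ⊕ shift J p , label J p

  cycle : Fin 3 → Fin m → Cycle ℓ n
  cycle s J = record { vtx = lifted s J ; inj = lifted-injective ; adj = lifted-adjacent }
    where
    lifted-injective : Injective _≡_ _≡_ (lifted s J)
    lifted-injective e = lift-injective J (cong₂ _,_ (⊕-cancelˡ s _ _ (cong proj₁ e)) (cong proj₂ e))
    lifted-adjacent : ∀ p → Adj (lifted s J p) (lifted s J (next p))
    lifted-adjacent p e with up J p | shift-next J p
    ... | true  | eq = ⊕1-irreflexive (s ⊕ shift J p) (trans e (trans (cong (s ⊕_) eq) (sym (⊕-assoc s _ _))))
    ... | false | eq = ⊕2-irreflexive (s ⊕ shift J p) (trans e (trans (cong (s ⊕_) eq) (sym (⊕-assoc s _ _))))

  cycles : Fin (3 * m) → Cycle ℓ n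
  cycles k = uncurry cycle (remQuot m k)

  shift-head : ∀ J p → shift J (head J p) ≡ shift J (tail J p) ⊕ 1₃
  shift-head J p with up J p | shift-next J p
  ... | true  | eq = eq
  ... | false | eq = sym (trans (cong (_⊕ 1₃) eq) (⊕2⊕1 (shift J p)))

  EdgeAt⇒tail-head : ∀ s J p u v → EdgeAt (cycle s J) p u v →
    (lifted s J (tail J p) ≡ u × lifted s J (head J p) ≡ v) ⊎
    (lifted s J (tail J p) ≡ v × lifted s J (head J p) ≡ u)
  EdgeAt⇒tail-head s J p u v e with up J p
  ... | true  = e
  ... | false with e
  ...   | inj₁ (e₁ , e₂) = inj₂ (e₂ , e₁)
  ...   | inj₂ (e₁ , e₂) = inj₁ (e₂ , e₁)

  tail-head⇒EdgeAt : ∀ s J p u v →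
    lifted s J (tail J p) ≡ u → lifted s J (head J p) ≡ v → EdgeAt (cycle s J) p u v
  tail-head⇒EdgeAt s J p u v e₁ e₂ with up J p
  ... | true  = inj₁ (e₁ , e₂)
  ... | false = inj₂ (e₂ , e₁)

  part-head : ∀ s J p → s ⊕ shift J (head J p) ≡ s ⊕ shift J (tail J p) ⊕ 1₃
  part-head s J p = trans (cong (s ⊕_) (shift-head J p)) (sym (⊕-assoc s _ _))

  EdgeAt⇒arc : ∀ s J p g x y → EdgeAt (cycle s J) p (g , x) (g ⊕ 1₃ , y) →
    arc (J , p) ≡ (x , y) × s ⊕ shift J (tail J p) ≡ g
  EdgeAt⇒arc s J p g x y e with EdgeAt⇒tail-head s J p _ _ e
  ... | inj₁ (e₁ , e₂) = cong₂ _,_ (cong proj₂ e₁) (cong proj₂ e₂) , cong proj₁ e₁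
  ... | inj₂ (e₁ , e₂) = ⊥-elim (⊕1⊕1-irreflexive g
        (trans (cong (_⊕ 1₃) (sym (cong proj₁ e₁))) (trans (sym (part-head s J p)) (cong proj₁ e₂))))

  arc⇒EdgeAt : ∀ s J p g x y → arc (J , p) ≡ (x , y) → s ⊕ shift J (tail J p) ≡ g →
    EdgeAt (cycle s J) p (g , x) (g ⊕ 1₃ , y)
  arc⇒EdgeAt s J p g x y a e = tail-head⇒EdgeAt s J p _ _
    (cong₂ _,_ e (,-injectiveˡ a))
    (cong₂ _,_ (trans (part-head s J p) (cong (_⊕ 1₃) e)) (,-injectiveʳ a))

  EdgeAt-sym : ∀ (C : Cycle ℓ n) i {u v} → EdgeAt C i u v → EdgeAt C i v u
  EdgeAt-sym C i (inj₁ (e₁ , e₂)) = inj₂ (e₁ , e₂)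
  EdgeAt-sym C i (inj₂ (e₁ , e₂)) = inj₁ (e₁ , e₂)

  uniqueArc : ∀ g x y → Σ (Fin (3 * m) × Fin ℓ) λ { (k , i) → EdgeAt (cycles k) i (g , x) (g ⊕ 1₃ , y) ×
      (∀ k' i' → EdgeAt (cycles k') i' (g , x) (g ⊕ 1₃ , y) → (k' ≡ k × i' ≡ i)) }
  uniqueArc g x y = (combine s J , p) , existence , uniqueness
    where
    J = proj₁ (arcIndex (x , y))
    p = proj₂ (arcIndex (x , y))
    s = g ⊖ shift J (tail J p)
    existence : EdgeAt (cycles (combine s J)) p (g , x) (g ⊕ 1₃ , y)
    existence = subst (λ r → EdgeAt (uncurry cycle r) p (g , x) (g ⊕ 1₃ , y)) (sym (remQuot-combine s J))
      (arc⇒EdgeAt s J p g x y (arc-arcIndex (x , y)) (⊖-⊕ g _))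
    uniqueness : ∀ k' i' → EdgeAt (cycles k') i' (g , x) (g ⊕ 1₃ , y) → (k' ≡ combine s J × i' ≡ p)
    uniqueness k' i' e = k'≡ , cong proj₂ index
      where
      s' = proj₁ (remQuot m k')
      J' = proj₂ (remQuot m k')
      arc≡ = EdgeAt⇒arc s' J' i' g x y e
      index : (J' , i') ≡ (J , p)
      index = trans (sym (arcIndex-arc (J' , i'))) (cong arcIndex (proj₁ arc≡))
      s'≡s : s' ≡ s
      s'≡s = trans (sym (⊕-⊖ s' _))
        (cong₂ _⊖_ (proj₂ arc≡) (cong (λ i → shift (proj₁ i) (tail (proj₁ i) (proj₂ i))) index))
      k'≡ : k' ≡ combine s J
      k'≡ = trans (sym (combine-remQuot m k')) (cong₂ combine s'≡s (cong proj₁ index))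

  decomposition : IsDecomposition cycles
  decomposition (g , x) (h , y) g≢h with ≢⇒⊕1 g h g≢h
  ... | inj₁ refl = uniqueArc g x y
  ... | inj₂ refl with uniqueArc h y x
  ...   | (k , i) , e , u = (k , i) , EdgeAt-sym (cycles k) i e , λ k' i' e' → u k' i' (EdgeAt-sym (cycles k') i' e')

-- ℓ = N + 1. The label N stands for ∞. The walks are indexed by j < N (the translates)
-- and by N (the spine).
module Walks (k : ℕ) where

  n N : ℕ
  n = 3 + k
  N = 6 + (k + k)

  n+n≡N : n + n ≡ N
  n+n≡N = sum≡ k
    where
    sum≡ : ∀ k → 3 + k + (3 + k) ≡ 6 + (k + k)
    sum≡ = solve-∀

  n+2+k≡N∸1 : n + (2 + k) ≡ N ∸ 1
  n+2+k≡N∸1 = sum≡ k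
    where
    sum≡ : ∀ k → 3 + k + (2 + k) ≡ 5 + (k + k)
    sum≡ = solve-∀

  open Translation N public

  -- Of the two arcs between z and z + 1, the spine takes the one oriented by θ z and the
  -- translate with j + n = z the other one; turnUp j is the orientation of the latter.
  θ : ℕ → Bool
  θ x = odd x ∨ (x ≡ᵇ 0)

  special : ℕ
  special = 4 + (k + k)

  turnUp : ℕ → Bool
  turnUp j = θ (j ⊞ n)

  turnIndex lastIndex : ℕ
  turnIndex = 1 + (k + k)
  lastIndex = 2 + (k + k)

  tailOffset : ℕ → ℕ
  tailOffset q = if odd q then N ∸ (2 + ⌊ q /2⌋) else 2 + ⌊ q /2⌋

  -- The translate walks take the flags s (j is special) and t (turnUp j) as arguments, so
  -- that their shape computes by pattern matching.
  translateLabel : Bool → ℕ → ℕ → ℕ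
  translateLabel s j 0 = N
  translateLabel s j 1 = if s then N else j ⊞ 1
  translateLabel s j 2 = if s then j ⊞ 1 else j ⊟ 1
  translateLabel s j 3 = if s then j ⊟ 1 else j ⊞ 2
  translateLabel s j (suc (suc (suc (suc q)))) = j ⊞ tailOffset q

  translateUp : Bool → Bool → ℕ → Bool
  translateUp s t 0 = if s then not t else true
  translateUp s t 1 = true
  translateUp s t 2 = s
  translateUp s t 3 = if s then false else not t
  translateUp s t (suc (suc (suc (suc q)))) = if q ≡ᵇ turnIndex then t else not (odd q)

  -- The parts are the running sums of the steps (see part-next), written out so that they
  -- compute.
  middlePart : Bool → Bool → Fin 3
  middlePart t b = if t then (if b then 1₃ else 0₃) else (if b then 0₃ else 2₃)

  translatePart : Bool → Bool → ℕ → Fin 3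
  translatePart s t 0 = 0₃
  translatePart s t 1 = if s then (if t then 2₃ else 1₃) else 1₃
  translatePart s t 2 = if s then (if t then 0₃ else 2₃) else 2₃
  translatePart s t 3 = if s then (if t then 1₃ else 0₃) else 1₃
  translatePart s t (suc (suc (suc (suc q)))) = if q ≡ᵇ lastIndex then 2₃ else middlePart t (odd q)

  spineLabel : ℕ → ℕ
  spineLabel = pred

  spineUp : ℕ → Bool
  spineUp 0 = true
  spineUp 1 = true
  spineUp (suc (suc q)) = not (odd q)

  spinePart : ℕ → Fin 3
  spinePart 0 = 0₃
  spinePart 1 = 1₃
  spinePart (suc (suc q)) = if odd q then 0₃ else 2₃

  label : ℕ → ℕ → ℕ
  label J p = if J ≡ᵇ N then spineLabel p else translateLabel (J ≡ᵇ special) J p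

  up : ℕ → ℕ → Bool
  up J p = if J ≡ᵇ N then spineUp p else translateUp (J ≡ᵇ special) (turnUp J) p

  part : ℕ → ℕ → Fin 3
  part J p = if J ≡ᵇ N then spinePart p else translatePart (J ≡ᵇ special) (turnUp J) p

  nextℕ : ℕ → ℕ
  nextℕ p = if p ≡ᵇ N then 0 else suc p

  arcOf : (ℕ → ℕ) → (ℕ → Bool) → ℕ → ℕ × ℕ
  arcOf lab u p = lab (if u p then p else nextℕ p) , lab (if u p then nextℕ p else p)

  arc : ℕ → ℕ → ℕ × ℕ
  arc J = arcOf (label J) (up J)

  translateArc : Bool → Bool → ℕ → ℕ → ℕ × ℕ
  translateArc s t j = arcOf (translateLabel s j) (translateUp s t)

  spineArc : ℕ → ℕ × ℕ
  spineArc = arcOf spineLabel spineUp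

  initialPosition : Bool → ℕ → ℕ
  initialPosition s i = if s then suc i else i

  -- arcIndexℕ (x , y) is the walk and position of the arc from x to y, found from the
  -- difference x − y.
  arcFrom∞ : ℕ → ℕ × ℕ
  arcFrom∞ y = if y ≡ᵇ N then (special , 0) else (y ⊟ 1 , (if y ⊟ 1 ≡ᵇ special then 1 else 0))

  arcTo∞ : ℕ → ℕ × ℕ
  arcTo∞ x = (x ⊞ n , N)

  loopIndex : ℕ → ℕ × ℕ
  loopIndex x = if x ≡ᵇ 0 then (N , 0) else (x ⊟ 2 , 3)

  stepIndex : ℕ → ℕ × ℕ
  stepIndex x = if θ (x ⊟ 1) then (x ⊞ (n ∸ 1) , N ∸ 1) else (N , x)

  stepBackIndex : ℕ → ℕ × ℕ
  stepBackIndex x = if θ x then (N , suc x) else (x ⊞ n , N ∸ 1)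

  translateIndex : ℕ → ℕ → ℕ × ℕ
  translateIndex x d = (x ⊟ ⌊ suc d /2⌋ , (if (x ⊟ ⌊ suc d /2⌋ ≡ᵇ special) ∨ (4 ≤ᵇ d) then d else pred d))

  differenceIndex : ℕ → ℕ → ℕ × ℕ
  differenceIndex x d = if d ≡ᵇ 1 then stepIndex x else (if d ≡ᵇ (N ∸ 1) then stepBackIndex x else translateIndex x d)

  arcIndexℕ : ℕ × ℕ → ℕ × ℕ
  arcIndexℕ (x , y) = if x ≡ᵇ N then arcFrom∞ y else
                  (if y ≡ᵇ N then arcTo∞ x else
                  (if x ≡ᵇ y then loopIndex x else differenceIndex x (x ⊟ y)))

  data Position : ℕ → Set where
    at0    : Position 0
    at1    : Position 1
    at2    : Position 2
    at3    : Position 3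
    middle : ∀ q → q < turnIndex → Position (4 + q)
    turn   : Position (N ∸ 1)
    last   : Position N

  position : ∀ p → p ≤ N → Position p
  position 0 _ = at0
  position 1 _ = at1
  position 2 _ = at2
  position 3 _ = at3
  position (suc (suc (suc (suc q)))) p≤N with m≤n⇒m<n∨m≡n (≤-pred (≤-pred (≤-pred (≤-pred p≤N))))
  ... | inj₂ refl = last
  ... | inj₁ q<lastIndex with m≤n⇒m<n∨m≡n (≤-pred q<lastIndex)
  ...   | inj₁ q<turnIndex = middle q q<turnIndex
  ...   | inj₂ refl = turn

  n<N∸1 : n < N ∸ 1
  n<N∸1 = s≤s (s≤s (s≤s (s≤s (≤-trans (m≤m+n k k) (n≤1+n _)))))

  n<N : n < N
  n<N = ≤-trans n<N∸1 (n≤1+n _)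

  middle<N : ∀ {q} → q < turnIndex → 4 + q < N
  middle<N q<turnIndex = s≤s (s≤s (s≤s (s≤s (≤-trans q<turnIndex (n≤1+n _)))))

  <N⇒≡ᵇ-false : ∀ {x} → x < N → (x ≡ᵇ N) ≡ false
  <N⇒≡ᵇ-false x<N = ≢⇒≡ᵇ-false (<⇒≢ x<N)

  nextℕ-< : ∀ {p} → p < N → nextℕ p ≡ suc p
  nextℕ-< p<N rewrite <N⇒≡ᵇ-false p<N = refl

  nextℕ-N : nextℕ N ≡ 0
  nextℕ-N rewrite ≡ᵇ-refl N = refl

  arcOf-up : ∀ lab u p → u p ≡ true → arcOf lab u p ≡ (lab p , lab (nextℕ p))
  arcOf-up lab u p e rewrite e = refl

  arcOf-down : ∀ lab u p → u p ≡ false → arcOf lab u p ≡ (lab (nextℕ p) , lab p)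
  arcOf-down lab u p e rewrite e = refl

  tailOffset-even : ∀ r → tailOffset (r + r) ≡ 2 + r
  tailOffset-even r rewrite odd-double r = cong (2 +_) (⌊double/2⌋ r)

  tailOffset-odd : ∀ r → tailOffset (suc (r + r)) ≡ N ∸ (2 + r)
  tailOffset-odd r rewrite odd-1+double r = cong (λ z → N ∸ (2 + z)) (⌊1+double/2⌋ r)

  translateUp-middle : ∀ s t {q} → q < turnIndex → translateUp s t (4 + q) ≡ not (odd q)
  translateUp-middle s t {q} q<turnIndex = cong (λ b → if b then t else not (odd q)) (≢⇒≡ᵇ-false (<⇒≢ q<turnIndex))

  translateLabel-turn : ∀ s j → translateLabel s j (N ∸ 1) ≡ j ⊞ (4 + k)
  translateLabel-turn s j = cong (j ⊞_) (trans (tailOffset-odd k) (m+n∸n≡m (4 + k) k))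

  translateLabel-last : ∀ s j → translateLabel s j N ≡ j ⊞ n
  translateLabel-last s j = cong (j ⊞_) (trans (cong tailOffset (cong suc (sym (+-suc k k)))) (tailOffset-even (suc k)))

  translateUp-turn : ∀ s t → translateUp s t (N ∸ 1) ≡ t
  translateUp-turn s t rewrite ≡ᵇ-refl (k + k) = refl

  translateUp-last : ∀ s t → translateUp s t N ≡ true
  translateUp-last s t rewrite ≢⇒≡ᵇ-false (1+n≢n {k + k}) | odd-double k = refl

  N∸1%N : (N ∸ 1) % N ≡ N ∸ 1
  N∸1%N = m<n⇒m%n≡m ≤-refl

  suc⊟1 : ∀ {q} → q < N → suc q ⊟ 1 ≡ q
  suc⊟1 {q} q<N = trans (cong (_% N) (sym (+-suc q (N ∸ 1)))) (trans (⊞-N q) (m<n⇒m%n≡m q<N))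

  ⊟N∸1 : ∀ x → x ⊟ (N ∸ 1) ≡ x ⊞ 1
  ⊟N∸1 x = cong (x ⊞_) (m∸[m∸n]≡n {N} {1} (s≤s z≤n))

  ⊞N : ∀ {x} → x < N → x ⊞ N ≡ x
  ⊞N {x} x<N = trans (⊞-N x) (m<n⇒m%n≡m x<N)

module ArcIndexing (k : ℕ) where
  open Walks k

  arc-translate : ∀ {j} p → j < N → arc j p ≡ translateArc (j ≡ᵇ special) (turnUp j) j p
  arc-translate p j<N rewrite <N⇒≡ᵇ-false j<N = refl

  arc-spine : ∀ p → arc N p ≡ spineArc p
  arc-spine p rewrite ≡ᵇ-refl N = refl

  arcIndex-from∞ : ∀ {y} → y < N → arcIndexℕ (N , y) ≡ (y ⊟ 1 , (if y ⊟ 1 ≡ᵇ special then 1 else 0))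
  arcIndex-from∞ y<N rewrite ≡ᵇ-refl N | <N⇒≡ᵇ-false y<N = refl

  arcIndex-∞∞ : arcIndexℕ (N , N) ≡ (special , 0)
  arcIndex-∞∞ rewrite ≡ᵇ-refl N = refl

  arcIndex-to∞ : ∀ {x} → x < N → arcIndexℕ (x , N) ≡ (x ⊞ n , N)
  arcIndex-to∞ x<N rewrite <N⇒≡ᵇ-false x<N | ≡ᵇ-refl N = refl

  arcIndex-loop : ∀ {x} → x < N → arcIndexℕ (x , x) ≡ loopIndex x
  arcIndex-loop {x} x<N rewrite <N⇒≡ᵇ-false x<N | ≡ᵇ-refl x = refl

  arcIndex-difference : ∀ {x y} → x < N → y < N → x ≢ y → arcIndexℕ (x , y) ≡ differenceIndex x (x ⊟ y)
  arcIndex-difference x<N y<N x≢y rewrite <N⇒≡ᵇ-false x<N | <N⇒≡ᵇ-false y<N | ≢⇒≡ᵇ-false x≢y = refl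

  arcIndex-zigzag : ∀ j a b d → j < N → a + b ≡ d → 2 ≤ d → d < N ∸ 1 → ⌊ suc d /2⌋ ≡ a →
    arcIndexℕ (j ⊞ a , j ⊟ b) ≡ (j , (if (j ≡ᵇ special) ∨ (4 ≤ᵇ d) then d else pred d))
  arcIndex-zigzag j a b d j<N a+b≡d 2≤d d<N-1 ⌊d+1/2⌋ = begin
    arcIndexℕ (j ⊞ a , j ⊟ b)                  ≡⟨ arcIndex-difference (⊞-< j a) (⊞-< j (N ∸ b)) ja≢j-b ⟩
    differenceIndex (j ⊞ a) (j ⊞ a ⊟ (j ⊟ b))  ≡⟨ cong (differenceIndex (j ⊞ a)) difference ⟩
    differenceIndex (j ⊞ a) d                   ≡⟨ generic ⟩
    translateIndex (j ⊞ a) d                    ≡⟨ cong (λ z → (z , (if (z ≡ᵇ special) ∨ (4 ≤ᵇ d) then d else pred d))) back ⟩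
    (j , (if (j ≡ᵇ special) ∨ (4 ≤ᵇ d) then d else pred d)) ∎
    where
    open ≡-Reasoning
    d<N : d < N
    d<N = ≤-trans d<N-1 (n≤1+n _)
    a≤N : a ≤ N
    a≤N = ≤-trans (m≤m+n a b) (≤-trans (≤-reflexive a+b≡d) (<⇒≤ d<N))
    b≤N : b ≤ N
    b≤N = ≤-trans (m≤n+m b a) (≤-trans (≤-reflexive a+b≡d) (<⇒≤ d<N))
    difference : j ⊞ a ⊟ (j ⊟ b) ≡ d
    difference = begin
      j ⊞ a ⊟ (j ⊞ (N ∸ b))      ≡⟨ ⊟-translate j a (m∸n≤m N b) ⟩
      (a + (N ∸ (N ∸ b))) % N    ≡⟨ cong (λ z → (a + z) % N) (m∸[m∸n]≡n b≤N) ⟩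
      (a + b) % N                ≡⟨ cong (_% N) a+b≡d ⟩
      d % N                      ≡⟨ m<n⇒m%n≡m d<N ⟩
      d                          ∎
    ja≢j-b : j ⊞ a ≢ j ⊟ b
    ja≢j-b e = 2≰0 (subst (2 ≤_) (trans (sym difference) (trans (cong (_⊟ (j ⊟ b)) e) (⊟-self (⊞-≤ j (N ∸ b))))) 2≤d)
      where
      2≰0 : ¬ 2 ≤ 0
      2≰0 ()
    generic : differenceIndex (j ⊞ a) d ≡ translateIndex (j ⊞ a) d
    generic rewrite ≢⇒≡ᵇ-false {d} {1} (λ d≡1 → <⇒≱ 2≤d (≤-reflexive d≡1)) | ≢⇒≡ᵇ-false (<⇒≢ d<N-1) = refl
    back : j ⊞ a ⊟ ⌊ suc d /2⌋ ≡ j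
    back = trans (cong (j ⊞ a ⊟_) ⌊d+1/2⌋) (trans (⊞-⊟ j a≤N) (m<n⇒m%n≡m j<N))

  initialArc : ℕ → ℕ → ℕ × ℕ
  initialArc j 0 = (N , j ⊞ 1)
  initialArc j 1 = (j ⊞ 1 , j ⊟ 1)
  initialArc j _ = (j ⊞ 2 , j ⊟ 1)

  translateArc-initial : ∀ s t j i → i < 3 → translateArc s t j (initialPosition s i) ≡ initialArc j i
  translateArc-initial true  t j 0 _ = refl
  translateArc-initial true  t j 1 _ = refl
  translateArc-initial true  t j 2 _ = refl
  translateArc-initial false t j 0 _ = refl
  translateArc-initial false t j 1 _ = refl
  translateArc-initial false t j 2 _ = refl
  translateArc-initial s t j (suc (suc (suc i))) (s≤s (s≤s (s≤s ())))

  translateArc-∞∞ : ∀ t j → translateArc true t j 0 ≡ (N , N)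
  translateArc-∞∞ true  j = refl
  translateArc-∞∞ false j = refl

  translateArc-loop : ∀ t j → translateArc false t j 3 ≡ (j ⊞ 2 , j ⊞ 2)
  translateArc-loop true  j = refl
  translateArc-loop false j = refl

  translateArc-middle : ∀ s t j q → q < turnIndex →
    translateArc s t j (4 + q) ≡ (j ⊞ ⌊ 5 + q /2⌋ , j ⊟ ⌊ 4 + q /2⌋)
  translateArc-middle s t j q q<turnIndex with halving q
  ... | twice r = begin
    translateArc s t j (4 + (r + r))
      ≡⟨ arcOf-up (translateLabel s j) (translateUp s t) (4 + (r + r))
           (trans (translateUp-middle s t q<turnIndex) (cong not (odd-double r))) ⟩
    (j ⊞ tailOffset (r + r) , translateLabel s j (nextℕ (4 + (r + r))))
      ≡⟨ cong₂ (λ a b → (j ⊞ a , translateLabel s j b)) (tailOffset-even r) (nextℕ-< (middle<N q<turnIndex)) ⟩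
    (j ⊞ (2 + r) , j ⊞ tailOffset (suc (r + r)))
      ≡⟨ cong₂ (λ a b → (j ⊞ a , j ⊞ b)) (cong (2 +_) (sym (⌊1+double/2⌋ r)))
           (trans (tailOffset-odd r) (cong (λ z → N ∸ (2 + z)) (sym (⌊double/2⌋ r)))) ⟩
    (j ⊞ ⌊ 5 + (r + r) /2⌋ , j ⊟ ⌊ 4 + (r + r) /2⌋) ∎
    where open ≡-Reasoning
  ... | twice+1 r = begin
    translateArc s t j (5 + (r + r))
      ≡⟨ arcOf-down (translateLabel s j) (translateUp s t) (5 + (r + r))
           (trans (translateUp-middle s t q<turnIndex) (cong not (odd-1+double r))) ⟩
    (translateLabel s j (nextℕ (5 + (r + r))) , j ⊞ tailOffset (suc (r + r)))
      ≡⟨ cong₂ (λ a b → (translateLabel s j a , j ⊞ b)) (nextℕ-< (middle<N q<turnIndex)) (tailOffset-odd r) ⟩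
    (j ⊞ tailOffset (2 + (r + r)) , j ⊟ (2 + r))
      ≡⟨ cong₂ (λ a b → (j ⊞ a , j ⊟ b))
           (trans (cong tailOffset (cong suc (sym (+-suc r r)))) (trans (tailOffset-even (suc r)) (cong (3 +_) (sym (⌊double/2⌋ r)))))
           (cong (2 +_) (sym (⌊1+double/2⌋ r))) ⟩
    (j ⊞ ⌊ 6 + (r + r) /2⌋ , j ⊟ ⌊ 5 + (r + r) /2⌋) ∎
    where open ≡-Reasoning

  translateArc-turn : ∀ s t j →
    translateArc s t j (N ∸ 1) ≡ (if t then (j ⊞ (4 + k) , j ⊞ n) else (j ⊞ n , j ⊞ (4 + k)))
  translateArc-turn s true j = trans (arcOf-up (translateLabel s j) (translateUp s true) (N ∸ 1) (translateUp-turn s true))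
    (cong₂ _,_ (translateLabel-turn s j) (trans (cong (translateLabel s j) (nextℕ-< ≤-refl)) (translateLabel-last s j)))
  translateArc-turn s false j = trans (arcOf-down (translateLabel s j) (translateUp s false) (N ∸ 1) (translateUp-turn s false))
    (cong₂ _,_ (trans (cong (translateLabel s j) (nextℕ-< ≤-refl)) (translateLabel-last s j)) (translateLabel-turn s j))

  translateArc-last : ∀ s t j → translateArc s t j N ≡ (j ⊞ n , N)
  translateArc-last s t j = trans (arcOf-up (translateLabel s j) (translateUp s t) N (translateUp-last s t))
    (cong₂ _,_ (translateLabel-last s j) (cong (translateLabel s j) nextℕ-N))

  arcIndex-initialArc : ∀ j i → j < N → i < 3 → arcIndexℕ (initialArc j i) ≡ (j , initialPosition (j ≡ᵇ special) i)
  arcIndex-initialArc j 0 j<N _ = trans (arcIndex-from∞ (⊞-< j 1))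
    (cong (λ z → (z , (if z ≡ᵇ special then 1 else 0))) (⊞-⊟-cancel 1 j<N (s≤s z≤n)))
  arcIndex-initialArc j 1 j<N _ = trans (arcIndex-zigzag j 1 1 2 j<N refl ≤-refl (s≤s (s≤s (s≤s z≤n))) refl)
    (cong (λ b → (j , (if b then 2 else 1))) (∨-identityʳ _))
  arcIndex-initialArc j 2 j<N _ = trans (arcIndex-zigzag j 2 1 3 j<N refl (s≤s (s≤s z≤n)) (s≤s (s≤s (s≤s (s≤s z≤n)))) refl)
    (cong (λ b → (j , (if b then 3 else 2))) (∨-identityʳ _))
  arcIndex-initialArc j (suc (suc (suc i))) j<N (s≤s (s≤s (s≤s ())))

  arcIndex-middle : ∀ j q → j < N → q < turnIndex → arcIndexℕ (j ⊞ ⌊ 5 + q /2⌋ , j ⊟ ⌊ 4 + q /2⌋) ≡ (j , 4 + q)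
  arcIndex-middle j q j<N q<turnIndex =
    trans (arcIndex-zigzag j ⌊ 5 + q /2⌋ ⌊ 4 + q /2⌋ (4 + q) j<N (trans (+-comm ⌊ 5 + q /2⌋ ⌊ 4 + q /2⌋) (⌊n/2⌋+⌈n/2⌉≡n (4 + q)))
            (s≤s (s≤s z≤n)) (s≤s (s≤s (s≤s (s≤s q<turnIndex)))) refl)
          (cong (λ b → (j , (if b then 4 + q else 3 + q))) (∨-zeroʳ _))

  arcIndex-step : ∀ {x y} → x < N → y < N → x ⊟ y ≡ 1 → arcIndexℕ (x , y) ≡ stepIndex x
  arcIndex-step {x} {y} x<N y<N x⊟y≡1 = trans (arcIndex-difference x<N y<N x≢y) (cong (differenceIndex x) x⊟y≡1)
    where
    x≢y : x ≢ y
    x≢y refl = 0≢1+n (trans (sym (⊟-self (<⇒≤ y<N))) x⊟y≡1)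

  arcIndex-stepBack : ∀ {x y} → x < N → y < N → x ⊟ y ≡ N ∸ 1 → arcIndexℕ (x , y) ≡ stepBackIndex x
  arcIndex-stepBack {x} {y} x<N y<N x⊟y≡N-1 = trans (arcIndex-difference x<N y<N x≢y)
    (trans (cong (differenceIndex x) x⊟y≡N-1) (cong (λ b → if b then stepBackIndex x else translateIndex x (N ∸ 1)) (≡ᵇ-refl (N ∸ 1))))
    where
    x≢y : x ≢ y
    x≢y refl = 0≢1+n (trans (sym (⊟-self (<⇒≤ y<N))) x⊟y≡N-1)

  N∸n≡n : N ∸ n ≡ n
  N∸n≡n = trans (cong (_∸ n) (sym n+n≡N)) (m+n∸n≡m n n)

  ⊞n⊞n : ∀ {j} → j < N → j ⊞ n ⊞ n ≡ j
  ⊞n⊞n {j} j<N = trans (⊞-⊞ j n n) (trans (cong (j ⊞_) n+n≡N) (⊞N j<N))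

  turn-difference-up : ∀ j → j ⊞ (4 + k) ⊟ (j ⊞ n) ≡ 1
  turn-difference-up j = trans (⊟-translate j (4 + k) (≤-trans (m≤m+n n n) (≤-reflexive n+n≡N)))
    (trans (cong (λ z → (4 + k + z) % N) N∸n≡n) (trans (cong (_% N) (cong suc n+n≡N)) (⊞-N 1)))

  4+k+2+k≡N : 4 + k + (2 + k) ≡ N
  4+k+2+k≡N = sum≡ k
    where
    sum≡ : ∀ k → 4 + k + (2 + k) ≡ 6 + (k + k)
    sum≡ = solve-∀

  turn-difference-down : ∀ j → j ⊞ n ⊟ (j ⊞ (4 + k)) ≡ N ∸ 1
  turn-difference-down j = trans (⊟-translate j n (≤-trans (m≤m+n (4 + k) (2 + k)) (≤-reflexive 4+k+2+k≡N)))
    (trans (cong (λ z → (n + z) % N) (m+n∸n≡m (2 + k) k))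
      (trans (cong (_% N) n+2+k≡N∸1) (m<n⇒m%n≡m ≤-refl)))

  4+k≡n+1 : 4 + k ≡ n + 1
  4+k≡n+1 = +-comm 1 n

  arcIndex-turn : ∀ j → j < N →
    arcIndexℕ (if turnUp j then (j ⊞ (4 + k) , j ⊞ n) else (j ⊞ n , j ⊞ (4 + k))) ≡ (j , N ∸ 1)
  arcIndex-turn j j<N with turnUp j in e
  ... | true = trans (arcIndex-step (⊞-< j (4 + k)) (⊞-< j n) (turn-difference-up j))
    (trans (cong (λ b → if b then (j ⊞ (4 + k) ⊞ (2 + k) , N ∸ 1) else (N , j ⊞ (4 + k))) (trans (cong θ back) e))
           (cong (_, N ∸ 1) (trans (⊞-⊞ j (4 + k) (2 + k)) (trans (cong (j ⊞_) 4+k+2+k≡N) (⊞N j<N)))))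
    where
    back : j ⊞ (4 + k) ⊟ 1 ≡ j ⊞ n
    back = trans (cong (λ a → j ⊞ a ⊟ 1) 4+k≡n+1) (trans (cong (_⊟ 1) (sym (⊞-⊞ j n 1))) (⊞-⊟-cancel 1 (⊞-< j n) (s≤s z≤n)))
  ... | false = trans (arcIndex-stepBack (⊞-< j n) (⊞-< j (4 + k)) (turn-difference-down j))
    (trans (cong (λ b → if b then (N , suc (j ⊞ n)) else (j ⊞ n ⊞ n , N ∸ 1)) e) (cong (_, N ∸ 1) (⊞n⊞n j<N)))

  arcIndex-last : ∀ j → j < N → arcIndexℕ (j ⊞ n , N) ≡ (j , N)
  arcIndex-last j j<N = trans (arcIndex-to∞ (⊞-< j n)) (cong (_, N) (⊞n⊞n j<N))

  special<N : special < N
  special<N = n≤1+n _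

  special⊞2≡0 : special ⊞ 2 ≡ 0
  special⊞2≡0 = trans (cong (_% N) (+-comm special 2)) (n%n≡0 N)

  ⊞2≡0⇒special : ∀ {j} → j < N → j ⊞ 2 ≡ 0 → j ≡ special
  ⊞2≡0⇒special {j} j<N e = trans (sym (⊞-⊟-cancel 2 j<N (s≤s (s≤s z≤n)))) (trans (cong (_⊟ 2) e) (m<n⇒m%n≡m special<N))

  arcIndex-translateLoop : ∀ j → j < N → (j ≡ᵇ special) ≡ false → arcIndexℕ (j ⊞ 2 , j ⊞ 2) ≡ (j , 3)
  arcIndex-translateLoop j j<N e = trans (arcIndex-loop (⊞-< j 2))
    (trans (cong (λ b → if b then (N , 0) else (j ⊞ 2 ⊟ 2 , 3)) (≢⇒≡ᵇ-false j⊞2≢0))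
           (cong (_, 3) (⊞-⊟-cancel 2 j<N (s≤s (s≤s z≤n)))))
    where
    j⊞2≢0 : j ⊞ 2 ≢ 0
    j⊞2≢0 j⊞2≡0 = ≡ᵇ-false⇒≢ e (⊞2≡0⇒special j<N j⊞2≡0)

  arcIndex-initial : ∀ {j} s i → j < N → i < 3 → (j ≡ᵇ special) ≡ s →
    arcIndexℕ (translateArc s (turnUp j) j (initialPosition s i)) ≡ (j , initialPosition s i)
  arcIndex-initial {j} s i j<N i<3 e = trans (cong arcIndexℕ (translateArc-initial s (turnUp j) j i i<3))
    (trans (arcIndex-initialArc j i j<N i<3) (cong (λ b → (j , initialPosition b i)) e))

  arcIndex-translateArc : ∀ j p → j < N → p ≤ N → arcIndexℕ (translateArc (j ≡ᵇ special) (turnUp j) j p) ≡ (j , p)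
  arcIndex-translateArc j p j<N p≤N with position p p≤N | j ≡ᵇ special in e
  ... | at0 | true  = trans (cong arcIndexℕ (translateArc-∞∞ (turnUp j) j)) (trans arcIndex-∞∞ (cong (_, 0) (sym (≡ᵇ-true⇒≡ e))))
  ... | at0 | false = arcIndex-initial false 0 j<N (s≤s z≤n) e
  ... | at1 | true  = arcIndex-initial true 0 j<N (s≤s z≤n) e
  ... | at1 | false = arcIndex-initial false 1 j<N (s≤s (s≤s z≤n)) e
  ... | at2 | true  = arcIndex-initial true 1 j<N (s≤s (s≤s z≤n)) e
  ... | at2 | false = arcIndex-initial false 2 j<N ≤-refl e
  ... | at3 | true  = arcIndex-initial true 2 j<N ≤-refl e
  ... | at3 | false = trans (cong arcIndexℕ (translateArc-loop (turnUp j) j)) (arcIndex-translateLoop j j<N e)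
  ... | middle q q<turnIndex | s = trans (cong arcIndexℕ (translateArc-middle s (turnUp j) j q q<turnIndex)) (arcIndex-middle j q j<N q<turnIndex)
  ... | turn | s = trans (cong arcIndexℕ (translateArc-turn s (turnUp j) j)) (arcIndex-turn j j<N)
  ... | last | s = trans (cong arcIndexℕ (translateArc-last s (turnUp j) j)) (arcIndex-last j j<N)

  spineUp-suc : ∀ q → spineUp (suc q) ≡ θ q
  spineUp-suc zero = refl
  spineUp-suc (suc q) = trans (sym (odd-suc q)) (sym (∨-identityʳ (odd (suc q))))

  θ-N∸1 : θ (N ∸ 1) ≡ true
  θ-N∸1 rewrite odd-1+double k = refl

  spineArc-suc : ∀ q → suc q < N → spineArc (suc q) ≡ (if θ q then (q , suc q) else (suc q , q))
  spineArc-suc q sq<N with θ q in e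
  ... | true  = trans (arcOf-up spineLabel spineUp (suc q) (trans (spineUp-suc q) e)) (cong (λ z → (q , pred z)) (nextℕ-< sq<N))
  ... | false = trans (arcOf-down spineLabel spineUp (suc q) (trans (spineUp-suc q) e)) (cong (λ z → (pred z , q)) (nextℕ-< sq<N))

  spineArc-N : spineArc N ≡ (N ∸ 1 , 0)
  spineArc-N = trans (arcOf-up spineLabel spineUp N (trans (spineUp-suc (N ∸ 1)) θ-N∸1)) (cong (λ z → (N ∸ 1 , pred z)) nextℕ-N)

  arcIndex-spineArc : ∀ p → p ≤ N → arcIndexℕ (spineArc p) ≡ (N , p)
  arcIndex-spineArc zero _ = arcIndex-loop {0} (s≤s z≤n)
  arcIndex-spineArc (suc q) sq≤N with m≤n⇒m<n∨m≡n sq≤N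
  ... | inj₂ refl = trans (cong arcIndexℕ spineArc-N)
    (trans (arcIndex-stepBack ≤-refl (s≤s z≤n) (trans (⊞-N (N ∸ 1)) (m<n⇒m%n≡m ≤-refl)))
           (cong (λ b → if b then (N , N) else (N ∸ 1 ⊞ n , N ∸ 1)) θ-N∸1))
  ... | inj₁ sq<N with θ q in e
  ...   | true = trans (cong arcIndexℕ (spineArc-suc q sq<N))
    (trans (cong (λ b → arcIndexℕ (if b then (q , suc q) else (suc q , q))) e)
    (trans (arcIndex-stepBack (<⇒≤ sq<N) sq<N q⊟suc-q)
           (cong (λ b → if b then (N , suc q) else (q ⊞ n , N ∸ 1)) e)))
    where
    q⊟suc-q : q ⊟ suc q ≡ N ∸ 1
    q⊟suc-q = trans (cong (λ z → pred z % N) (m+[n∸m]≡n (<⇒≤ sq<N))) (m<n⇒m%n≡m ≤-refl)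
  ...   | false = trans (cong arcIndexℕ (spineArc-suc q sq<N))
    (trans (cong (λ b → arcIndexℕ (if b then (q , suc q) else (suc q , q))) e)
    (trans (arcIndex-step sq<N (<⇒≤ sq<N) suc-q⊟q)
           (cong (λ b → if b then (suc q ⊞ (n ∸ 1) , N ∸ 1) else (N , suc q)) (trans (cong θ (suc⊟1 (<⇒≤ sq<N))) e))))
    where
    suc-q⊟q : suc q ⊟ q ≡ 1
    suc-q⊟q = trans (cong (λ z → suc z % N) (m+[n∸m]≡n (<⇒≤ (<⇒≤ sq<N)))) (⊞-N 1)

  arcIndex-arc : ∀ J p → J ≤ N → p ≤ N → arcIndexℕ (arc J p) ≡ (J , p)
  arcIndex-arc J p J≤N p≤N with m≤n⇒m<n∨m≡n J≤N
  ... | inj₁ J<N = trans (cong arcIndexℕ (arc-translate p J<N)) (arcIndex-translateArc J p J<N p≤N)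
  ... | inj₂ refl = trans (cong arcIndexℕ (arc-spine p)) (arcIndex-spineArc p p≤N)

  Indexes : ℕ × ℕ → ℕ × ℕ → Set
  Indexes e (J , p) = J ≤ N × p ≤ N × arc J p ≡ e

  indexes-translate : ∀ {j p e} → j < N → p ≤ N → translateArc (j ≡ᵇ special) (turnUp j) j p ≡ e → Indexes e (j , p)
  indexes-translate {p = p} j<N p≤N a = <⇒≤ j<N , p≤N , trans (arc-translate p j<N) a

  indexes-spine : ∀ {p e} → p ≤ N → spineArc p ≡ e → Indexes e (N , p)
  indexes-spine {p} p≤N a = ≤-refl , p≤N , trans (arc-spine p) a

  initialPosition≤N : ∀ s i → i < 3 → initialPosition s i ≤ N
  initialPosition≤N true  i i<3 = ≤-trans i<3 (s≤s (s≤s (s≤s z≤n)))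
  initialPosition≤N false i i<3 = ≤-trans (<⇒≤ i<3) (s≤s (s≤s (s≤s z≤n)))

  indexes-initial : ∀ j i {e} → j < N → i < 3 → initialArc j i ≡ e →
    Indexes e (j , initialPosition (j ≡ᵇ special) i)
  indexes-initial j i j<N i<3 a =
    indexes-translate j<N (initialPosition≤N (j ≡ᵇ special) i i<3) (trans (translateArc-initial (j ≡ᵇ special) (turnUp j) j i i<3) a)

  indexes-∞∞ : Indexes (N , N) (arcIndexℕ (N , N))
  indexes-∞∞ rewrite arcIndex-∞∞ =
    indexes-translate special<N z≤n
      (trans (cong (λ s → translateArc s (turnUp special) special 0) (≡ᵇ-refl special)) (translateArc-∞∞ (turnUp special) special))

  indexes-from∞ : ∀ {y} → y < N → Indexes (N , y) (arcIndexℕ (N , y))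
  indexes-from∞ {y} y<N rewrite arcIndex-from∞ y<N =
    indexes-initial (y ⊟ 1) 0 (⊞-< y (N ∸ 1)) (s≤s z≤n) (cong (N ,_) (⊟-⊞-cancel 1 y<N (s≤s z≤n)))

  indexes-to∞ : ∀ {x} → x < N → Indexes (x , N) (arcIndexℕ (x , N))
  indexes-to∞ {x} x<N rewrite arcIndex-to∞ x<N =
    indexes-translate (⊞-< x n) ≤-refl (trans (translateArc-last ((x ⊞ n) ≡ᵇ special) (turnUp (x ⊞ n)) (x ⊞ n)) (cong (_, N) (⊞n⊞n x<N)))

  indexes-loop : ∀ {x} → x < N → Indexes (x , x) (arcIndexℕ (x , x))
  indexes-loop {x} x<N rewrite arcIndex-loop x<N with x
  ... | zero = indexes-spine z≤n refl
  ... | suc x′ = indexes-translate (⊞-< (suc x′) (N ∸ 2)) (s≤s (s≤s (s≤s z≤n)))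
    (trans (cong (λ s → translateArc s (turnUp j) j 3) (≢⇒≡ᵇ-false j≢special))
           (trans (translateArc-loop (turnUp j) j) (cong₂ _,_ back back)))
    where
    j = suc x′ ⊟ 2
    back : j ⊞ 2 ≡ suc x′
    back = ⊟-⊞-cancel 2 x<N (s≤s (s≤s z≤n))
    j≢special : j ≢ special
    j≢special j≡special = 0≢1+n (trans (sym special⊞2≡0) (trans (cong (_⊞ 2) (sym j≡special)) back))

  indexes-step : ∀ {x} → x < N → Indexes (x , x ⊟ 1) (stepIndex x)
  indexes-step {x} x<N with θ (x ⊟ 1) in e
  ... | true = indexes-translate (⊞-< x (2 + k)) (n≤1+n _)
      (trans (translateArc-turn _ (turnUp j) j)
        (trans (cong (λ b → if b then (j ⊞ (4 + k) , j ⊞ n) else (j ⊞ n , j ⊞ (4 + k))) turnUp-j) (cong₂ _,_ jk4 jn)))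
    where
    j = x ⊞ (2 + k)
    jn : j ⊞ n ≡ x ⊟ 1
    jn = trans (⊞-⊞ x (2 + k) n) (cong (x ⊞_) (trans (+-comm (2 + k) n) n+2+k≡N∸1))
    jk4 : j ⊞ (4 + k) ≡ x
    jk4 = trans (⊞-⊞ x (2 + k) (4 + k)) (trans (cong (x ⊞_) (trans (+-comm (2 + k) (4 + k)) 4+k+2+k≡N)) (⊞N x<N))
    turnUp-j : turnUp j ≡ true
    turnUp-j = trans (cong θ jn) e
  ... | false = spine x x<N e
    where
    spine : ∀ x → x < N → θ (x ⊟ 1) ≡ false → Indexes (x , x ⊟ 1) (N , x)
    spine zero _ e′ with () ← trans (sym θ-N∸1) (trans (cong θ (sym N∸1%N)) e′)
    spine (suc q) sq<N e′ = indexes-spine (<⇒≤ sq<N)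
      (trans (spineArc-suc q sq<N) (trans (cong (λ b → if b then (q , suc q) else (suc q , q)) (trans (cong θ q≡) e′)) (cong (suc q ,_) q≡)))
      where
      q≡ : q ≡ suc q ⊟ 1
      q≡ = sym (suc⊟1 (<⇒≤ sq<N))

  indexes-stepBack : ∀ {x} → x < N → Indexes (x , x ⊟ (N ∸ 1)) (stepBackIndex x)
  indexes-stepBack {x} x<N rewrite ⊟N∸1 x with θ x in e
  ... | true with m≤n⇒m<n∨m≡n x<N
  ...   | inj₁ sx<N = indexes-spine x<N (trans (spineArc-suc x sx<N)
      (trans (cong (λ b → if b then (x , suc x) else (suc x , x)) e) (cong (x ,_) (sym x⊞1))))
    where
    x⊞1 : x ⊞ 1 ≡ suc x
    x⊞1 = trans (cong (_% N) (+-comm x 1)) (m<n⇒m%n≡m sx<N)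
  ...   | inj₂ refl = indexes-spine ≤-refl (trans spineArc-N (cong (N ∸ 1 ,_) (sym N∸1⊞1)))
    where
    N∸1⊞1 : N ∸ 1 ⊞ 1 ≡ 0
    N∸1⊞1 = trans (cong (_% N) (+-comm (N ∸ 1) 1)) (n%n≡0 N)
  indexes-stepBack {x} x<N | false = indexes-translate (⊞-< x n) (n≤1+n _)
    (trans (translateArc-turn _ (turnUp j) j)
      (trans (cong (λ b → if b then (j ⊞ (4 + k) , j ⊞ n) else (j ⊞ n , j ⊞ (4 + k))) turnUp-j) (cong₂ _,_ (⊞n⊞n x<N) j4k)))
    where
    j = x ⊞ n
    turnUp-j : turnUp j ≡ false
    turnUp-j = trans (cong θ (⊞n⊞n x<N)) e
    j4k : j ⊞ (4 + k) ≡ x ⊞ 1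
    j4k = trans (⊞-⊞ x n (4 + k)) (trans (cong (x ⊞_) (trans (+-suc n n) (cong suc n+n≡N)))
      (trans (sym (⊞-⊞ x 1 N)) (trans (⊞-N (x ⊞ 1)) (m%n%n≡m%n (x + 1) N))))

  indexes-initialDifference : ∀ {x} i → x < N → 1 ≤ i → i < 3 → Indexes (x , x ⊟ suc i) (translateIndex x (suc i))
  indexes-initialDifference {x} 1 x<N _ _ = subst (Indexes (x , x ⊟ 2)) (cong (λ b → (x ⊟ 1 , (if b then 2 else 1))) (sym (∨-identityʳ _)))
    (indexes-initial (x ⊟ 1) 1 (⊞-< x (N ∸ 1)) (s≤s (s≤s z≤n))
      (cong₂ _,_ (⊟-⊞-cancel 1 x<N (s≤s z≤n)) (⊟-⊟ x 1 1 (s≤s (s≤s z≤n)))))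
  indexes-initialDifference {x} 2 x<N _ _ = subst (Indexes (x , x ⊟ 3)) (cong (λ b → (x ⊟ 2 , (if b then 3 else 2))) (sym (∨-identityʳ _)))
    (indexes-initial (x ⊟ 2) 2 (⊞-< x (N ∸ 2)) ≤-refl
      (cong₂ _,_ (⊟-⊞-cancel 2 x<N (s≤s (s≤s z≤n))) (⊟-⊟ x 2 1 (s≤s (s≤s (s≤s z≤n))))))
  indexes-initialDifference (suc (suc (suc i))) _ _ (s≤s (s≤s (s≤s ())))

  indexes-middle : ∀ {x} q → x < N → q < turnIndex → Indexes (x , x ⊟ (4 + q)) (translateIndex x (4 + q))
  indexes-middle {x} q x<N q<turnIndex = subst (Indexes (x , x ⊟ (4 + q))) (cong (λ b → (j , (if b then 4 + q else 3 + q))) (sym (∨-zeroʳ _)))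
    (indexes-translate (⊞-< x (N ∸ a)) 4+q≤N
      (trans (translateArc-middle _ (turnUp j) j q q<turnIndex)
             (cong₂ _,_ (⊟-⊞-cancel a x<N (≤-trans (m≤m+n a b) a+b≤N)) (trans (⊟-⊟ x a b a+b≤N) (cong (x ⊟_) a+b≡)))))
    where
    a = ⌊ 5 + q /2⌋
    b = ⌊ 4 + q /2⌋
    j = x ⊟ a
    a+b≡ : a + b ≡ 4 + q
    a+b≡ = trans (+-comm a b) (⌊n/2⌋+⌈n/2⌉≡n (4 + q))
    4+q≤N : 4 + q ≤ N
    4+q≤N = <⇒≤ (middle<N q<turnIndex)
    a+b≤N : a + b ≤ N
    a+b≤N = ≤-trans (≤-reflexive a+b≡) 4+q≤N

  indexes-difference : ∀ {x d} → x < N → d < N → d ≢ 0 → Indexes (x , x ⊟ d) (differenceIndex x d)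
  indexes-difference {x} {d} x<N d<N d≢0 with position d (<⇒≤ d<N)
  ... | at0 = ⊥-elim (d≢0 refl)
  ... | at1 = indexes-step x<N
  ... | at2 = indexes-initialDifference 1 x<N (s≤s z≤n) (s≤s (s≤s z≤n))
  ... | at3 = indexes-initialDifference 2 x<N (s≤s z≤n) ≤-refl
  ... | middle q q<turnIndex rewrite ≢⇒≡ᵇ-false {4 + q} {N ∸ 1} (<⇒≢ (s≤s (s≤s (s≤s (s≤s q<turnIndex))))) = indexes-middle q x<N q<turnIndex
  ... | turn rewrite ≡ᵇ-refl (N ∸ 1) = indexes-stepBack x<N
  ... | last = ⊥-elim (<-irrefl refl d<N)

  arc-arcIndex : ∀ x y → x ≤ N → y ≤ N → Indexes (x , y) (arcIndexℕ (x , y))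
  arc-arcIndex x y x≤N y≤N with m≤n⇒m<n∨m≡n x≤N | m≤n⇒m<n∨m≡n y≤N
  ... | inj₂ refl | inj₂ refl = indexes-∞∞
  ... | inj₂ refl | inj₁ y<N  = indexes-from∞ y<N
  ... | inj₁ x<N  | inj₂ refl = indexes-to∞ x<N
  ... | inj₁ x<N  | inj₁ y<N with x ≟ y
  ...   | yes refl = indexes-loop x<N
  ...   | no x≢y rewrite arcIndex-difference x<N y<N x≢y =
    subst (λ z → Indexes (x , z) (differenceIndex x (x ⊟ y))) (⊟-⊟-self x<N y<N)
      (indexes-difference x<N (⊞-< x (N ∸ y)) (λ d≡0 → x≢y (⊟≡0⇒≡ x<N y<N d≡0)))

module PartSteps (k : ℕ) where
  open Walks k

  translatePart-next-initial : ∀ s t p → p < 4 →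
    translatePart s t (suc p) ≡ translatePart s t p ⊕ step (translateUp s t p)
  translatePart-next-initial true  true  0 _ = refl
  translatePart-next-initial true  false 0 _ = refl
  translatePart-next-initial false true  0 _ = refl
  translatePart-next-initial false false 0 _ = refl
  translatePart-next-initial true  true  1 _ = refl
  translatePart-next-initial true  false 1 _ = refl
  translatePart-next-initial false true  1 _ = refl
  translatePart-next-initial false false 1 _ = refl
  translatePart-next-initial true  true  2 _ = refl
  translatePart-next-initial true  false 2 _ = refl
  translatePart-next-initial false true  2 _ = refl
  translatePart-next-initial false false 2 _ = refl
  translatePart-next-initial true  true  3 _ = refl
  translatePart-next-initial true  false 3 _ = refl
  translatePart-next-initial false true  3 _ = refl
  translatePart-next-initial false false 3 _ = refl
  translatePart-next-initial s t (suc (suc (suc (suc p)))) (s≤s (s≤s (s≤s (s≤s ()))))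

  middlePart-step : ∀ t b → middlePart t (not b) ≡ middlePart t b ⊕ step (not b)
  middlePart-step true  true  = refl
  middlePart-step true  false = refl
  middlePart-step false true  = refl
  middlePart-step false false = refl

  translatePart-middle : ∀ s t {q} → q < lastIndex → translatePart s t (4 + q) ≡ middlePart t (odd q)
  translatePart-middle s t {q} q<lastIndex = cong (λ b → if b then 2₃ else middlePart t (odd q)) (≢⇒≡ᵇ-false (<⇒≢ q<lastIndex))

  translatePart-next-middle : ∀ s t q → q < turnIndex →
    translatePart s t (5 + q) ≡ translatePart s t (4 + q) ⊕ step (translateUp s t (4 + q))
  translatePart-next-middle s t q q<turnIndex = begin
    translatePart s t (5 + q)                           ≡⟨ translatePart-middle s t (s≤s q<turnIndex) ⟩
    middlePart t (odd (suc q))                          ≡⟨ cong (middlePart t) (odd-suc q) ⟩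
    middlePart t (not (odd q))                          ≡⟨ middlePart-step t (odd q) ⟩
    middlePart t (odd q) ⊕ step (not (odd q))
      ≡⟨ cong₂ (λ a b → a ⊕ step b) (sym (translatePart-middle s t (≤-trans q<turnIndex (n≤1+n _))))
           (sym (translateUp-middle s t q<turnIndex)) ⟩
    translatePart s t (4 + q) ⊕ step (translateUp s t (4 + q)) ∎
    where open ≡-Reasoning

  translatePart-N : ∀ s t → translatePart s t N ≡ 2₃
  translatePart-N s t = cong (λ b → if b then 2₃ else middlePart t (odd lastIndex)) (≡ᵇ-refl lastIndex)

  translatePart-next-turn : ∀ s t → translatePart s t N ≡ translatePart s t (N ∸ 1) ⊕ step (translateUp s t (N ∸ 1))
  translatePart-next-turn s t = begin
    translatePart s t N                      ≡⟨ translatePart-N s t ⟩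
    2₃                                       ≡⟨ closes t ⟩
    middlePart t true ⊕ step t
      ≡⟨ cong₂ (λ a b → a ⊕ step b) (sym (trans (translatePart-middle s t ≤-refl) (cong (middlePart t) (odd-1+double k))))
           (sym (translateUp-turn s t)) ⟩
    translatePart s t (N ∸ 1) ⊕ step (translateUp s t (N ∸ 1)) ∎
    where
    open ≡-Reasoning
    closes : ∀ t → 2₃ ≡ middlePart t true ⊕ step t
    closes true  = refl
    closes false = refl

  translatePart-next-last : ∀ s t → translatePart s t 0 ≡ translatePart s t N ⊕ step (translateUp s t N)
  translatePart-next-last s t = sym (cong₂ (λ a b → a ⊕ step b) (translatePart-N s t) (translateUp-last s t))

  translatePart-next : ∀ s t p → p ≤ N → translatePart s t (nextℕ p) ≡ translatePart s t p ⊕ step (translateUp s t p)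
  translatePart-next s t p p≤N with position p p≤N
  ... | at0 = translatePart-next-initial s t 0 (s≤s z≤n)
  ... | at1 = translatePart-next-initial s t 1 (s≤s (s≤s z≤n))
  ... | at2 = translatePart-next-initial s t 2 (s≤s (s≤s (s≤s z≤n)))
  ... | at3 = translatePart-next-initial s t 3 ≤-refl
  ... | middle q q<turnIndex = trans (cong (translatePart s t) (nextℕ-< (middle<N q<turnIndex))) (translatePart-next-middle s t q q<turnIndex)
  ... | turn = trans (cong (translatePart s t) (nextℕ-< ≤-refl)) (translatePart-next-turn s t)
  ... | last = trans (cong (translatePart s t) nextℕ-N) (translatePart-next-last s t)

  spinePart-next : ∀ p → p ≤ N → spinePart (nextℕ p) ≡ spinePart p ⊕ step (spineUp p)
  spinePart-next 0 _ = refl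
  spinePart-next 1 _ = refl
  spinePart-next (suc (suc q)) p≤N with m≤n⇒m<n∨m≡n p≤N
  ... | inj₂ refl rewrite nextℕ-N | odd-double k = refl
  ... | inj₁ p<N = trans (cong spinePart (nextℕ-< p<N)) (trans (cong (λ b → if b then 0₃ else 2₃) (odd-suc q)) (alternates (odd q)))
    where
    alternates : ∀ b → (if not b then 0₃ else 2₃) ≡ (if b then 0₃ else 2₃) ⊕ step (not b)
    alternates true  = refl
    alternates false = refl

  part-next : ∀ J p → J ≤ N → p ≤ N → part J (nextℕ p) ≡ part J p ⊕ step (up J p)
  part-next J p J≤N p≤N with m≤n⇒m<n∨m≡n J≤N
  ... | inj₁ J<N rewrite ≢⇒≡ᵇ-false (<⇒≢ J<N) = translatePart-next _ _ p p≤N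
  ... | inj₂ refl rewrite ≡ᵇ-refl N = spinePart-next p p≤N

module VertexPositions (k : ℕ) where
  open Walks k

  isZero isOne : Fin 3 → Bool
  isZero zero = true
  isZero (suc _) = false
  isOne (suc zero) = true
  isOne _ = false

  offsetPosition : Bool → Fin 3 → ℕ → ℕ
  offsetPosition s g a =
    if a ≡ᵇ 1 then initialPosition s 1 else
    (if a ≡ᵇ N ∸ 1 then initialPosition s 2 else
    (if a ≡ᵇ 2 then (if s then 4 else (if isOne g then 3 else 4)) else
    (if a ≤ᵇ n then a + a else suc ((N ∸ a) + (N ∸ a)))))

  translatePosition : Bool → ℕ → Fin 3 → ℕ → ℕ
  translatePosition s j g x = if x ≡ᵇ N then (if s then (if isZero g then 0 else 1) else 0) else offsetPosition s g (x ⊟ j)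

  spinePosition : Fin 3 → ℕ → ℕ
  spinePosition g x = if x ≡ᵇ 0 then (if isZero g then 0 else 1) else suc x

  vertexPosition : ℕ → Fin 3 → ℕ → ℕ
  vertexPosition J g x = if J ≡ᵇ N then spinePosition g x else translatePosition (J ≡ᵇ special) J g x

  offsetPosition-small : ∀ s g a → 3 ≤ a → a ≤ n → offsetPosition s g a ≡ a + a
  offsetPosition-small s g a 3≤a a≤n
    rewrite ≢⇒≡ᵇ-false (>⇒≢ (≤-trans (s≤s (s≤s z≤n)) 3≤a))
          | ≢⇒≡ᵇ-false (<⇒≢ (≤-trans (s≤s a≤n) n<N∸1))
          | ≢⇒≡ᵇ-false (>⇒≢ 3≤a)
          | ≤⇒≤ᵇ≡true a≤n = refl

  offsetPosition-large : ∀ s g a → n < a → a < N ∸ 1 → offsetPosition s g a ≡ suc ((N ∸ a) + (N ∸ a))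
  offsetPosition-large s g a n<a a<N∸1
    rewrite ≢⇒≡ᵇ-false (>⇒≢ (≤-trans (s≤s (s≤s z≤n)) n<a))
          | ≢⇒≡ᵇ-false (<⇒≢ a<N∸1)
          | ≢⇒≡ᵇ-false (>⇒≢ (≤-trans (s≤s (s≤s (s≤s z≤n))) n<a))
          | >⇒≤ᵇ≡false n<a = refl

  offsetPosition-N∸1 : ∀ s g → offsetPosition s g (N ∸ 1) ≡ initialPosition s 2
  offsetPosition-N∸1 s g rewrite ≡ᵇ-refl (k + k) = refl

  translatePosition-∞ : ∀ s j g → translatePosition s j g N ≡ (if s then (if isZero g then 0 else 1) else 0)
  translatePosition-∞ s j g rewrite ≡ᵇ-refl N = refl

  translatePosition-offset : ∀ s j g a → j < N → a < N → translatePosition s j g (j ⊞ a) ≡ offsetPosition s g a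
  translatePosition-offset s j g a j<N a<N rewrite ≢⇒≡ᵇ-false (<⇒≢ (⊞-< j a)) | ⊞-⊟-offset j<N a<N = refl

  offsetPosition-tail : ∀ s g q → suc q ≤ lastIndex →
    tailOffset (suc q) < N × offsetPosition s g (tailOffset (suc q)) ≡ 5 + q
  offsetPosition-tail s g q 1+q≤lastIndex with halving q
  ... | twice r = subst (λ a → a < N × offsetPosition s g a ≡ 5 + (r + r)) (sym (tailOffset-odd r))
      (s≤s (∸-monoʳ-≤ N (s≤s (z≤n {1 + r}))) ,
       trans (offsetPosition-large s g (N ∸ (2 + r)) n<a (s≤s (∸-monoʳ-≤ N (s≤s (s≤s (z≤n {r}))))))
             (cong suc (trans (cong (λ z → z + z) (m∸[m∸n]≡n 2+r≤N)) (sum≡ r))))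
    where
    r≤k : r ≤ k
    r≤k = double-≤ (≤-pred 1+q≤lastIndex)
    sum≡ : ∀ r → 2 + r + (2 + r) ≡ 4 + (r + r)
    sum≡ = solve-∀
    2+r≤N : 2 + r ≤ N
    2+r≤N = ≤-trans (s≤s (s≤s r≤k)) (≤-trans (n≤1+n (2 + k)) (<⇒≤ n<N))
    n<a : n < N ∸ (2 + r)
    n<a = subst (_≤ N ∸ (2 + r)) (m+n∸n≡m (4 + k) k) (∸-monoʳ-≤ N (s≤s (s≤s r≤k)))
  ... | twice+1 r = subst (λ a → a < N × offsetPosition s g a ≡ 6 + (r + r)) (sym tailOffset≡)
      (≤-trans (s≤s (s≤s (s≤s (s≤s r≤k)))) n<N ,
       trans (offsetPosition-small s g (3 + r) (s≤s (s≤s (s≤s z≤n))) (s≤s (s≤s (s≤s r≤k)))) (sum≡ r))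
    where
    r≤k : r ≤ k
    r≤k = double-≤ (m≤n⇒m≤1+n (≤-pred (≤-pred 1+q≤lastIndex)))
    tailOffset≡ : tailOffset (2 + (r + r)) ≡ 3 + r
    tailOffset≡ = trans (cong (λ z → tailOffset (suc z)) (sym (+-suc r r))) (tailOffset-even (suc r))
    sum≡ : ∀ r → 3 + r + (3 + r) ≡ 6 + (r + r)
    sum≡ = solve-∀

  translatePosition-label : ∀ s t j p → j < N → p ≤ N →
    translatePosition s j (translatePart s t p) (translateLabel s j p) ≡ p
  translatePosition-label true  t     j 0 _ _ = translatePosition-∞ true j 0₃
  translatePosition-label false t     j 0 _ _ = translatePosition-∞ false j 0₃
  translatePosition-label true  true  j 1 _ _ = translatePosition-∞ true j 2₃
  translatePosition-label true  false j 1 _ _ = translatePosition-∞ true j 1₃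
  translatePosition-label false t     j 1 j<N _ = translatePosition-offset false j 1₃ 1 j<N (s≤s (s≤s z≤n))
  translatePosition-label true  t     j 2 j<N _ = translatePosition-offset true j (translatePart true t 2) 1 j<N (s≤s (s≤s z≤n))
  translatePosition-label false t     j 2 j<N _ =
    trans (translatePosition-offset false j 2₃ (N ∸ 1) j<N ≤-refl) (offsetPosition-N∸1 false 2₃)
  translatePosition-label true  t     j 3 j<N _ =
    trans (translatePosition-offset true j (translatePart true t 3) (N ∸ 1) j<N ≤-refl) (offsetPosition-N∸1 true (translatePart true t 3))
  translatePosition-label false t     j 3 j<N _ = translatePosition-offset false j 1₃ 2 j<N (s≤s (s≤s (s≤s z≤n)))
  translatePosition-label true  t     j 4 j<N _ = translatePosition-offset true j (translatePart true t 4) 2 j<N (s≤s (s≤s (s≤s z≤n)))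
  translatePosition-label false true  j 4 j<N _ = translatePosition-offset false j 0₃ 2 j<N (s≤s (s≤s (s≤s z≤n)))
  translatePosition-label false false j 4 j<N _ = translatePosition-offset false j 2₃ 2 j<N (s≤s (s≤s (s≤s z≤n)))
  translatePosition-label s t j (suc (suc (suc (suc (suc q))))) j<N p≤N =
    trans (translatePosition-offset s j (translatePart s t (5 + q)) (tailOffset (suc q)) j<N (proj₁ tail))
          (proj₂ tail)
    where
    tail = offsetPosition-tail s (translatePart s t (5 + q)) q (≤-pred (≤-pred (≤-pred (≤-pred p≤N))))

  spinePosition-label : ∀ p → spinePosition (spinePart p) (spineLabel p) ≡ p
  spinePosition-label 0 = refl
  spinePosition-label 1 = refl
  spinePosition-label (suc (suc q)) = refl

  vertexPosition-label : ∀ J p → J ≤ N → p ≤ N → vertexPosition J (part J p) (label J p) ≡ p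
  vertexPosition-label J p J≤N p≤N with m≤n⇒m<n∨m≡n J≤N
  ... | inj₁ J<N rewrite ≢⇒≡ᵇ-false (<⇒≢ J<N) = translatePosition-label _ _ J p J<N p≤N
  ... | inj₂ refl rewrite ≡ᵇ-refl N = spinePosition-label p

module Colouring (k : ℕ) where
  open Walks k

  red : ℕ → Bool
  red x = not (odd x)

  redAt : ℕ → ℕ → Bool
  redAt j a = red (j + a)

  redAt-suc : ∀ j a → redAt j (suc a) ≡ not (redAt j a)
  redAt-suc j a = trans (cong red (+-suc j a)) (cong not (odd-suc (j + a)))

  red-⊞ : ∀ j a → red (j ⊞ a) ≡ redAt j a
  red-⊞ j a = cong not (odd-%-even (j + a) {M = n} (sym n+n≡N))

  red-⊟ : ∀ j {b} → b ≤ N → red (j ⊟ b) ≡ redAt j b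
  red-⊟ j {b} b≤N = cong not (trans (odd-%-even (j + (N ∸ b)) {M = n} (sym n+n≡N)) (odd-∸-even j {M = n} b≤N (sym n+n≡N)))

  red-N : red N ≡ true
  red-N = cong not (odd-double k)

  red-tail : ∀ s j q → q ≤ lastIndex → red (translateLabel s j (4 + q)) ≡ redAt j (2 + ⌊ q /2⌋)
  red-tail s j q q≤lastIndex with halving q
  ... | twice r = trans (cong (λ a → red (j ⊞ a)) (tailOffset-even r)) (trans (red-⊞ j (2 + r)) (cong (λ z → redAt j (2 + z)) (sym (⌊double/2⌋ r))))
  ... | twice+1 r = trans (cong (λ a → red (j ⊞ a)) (tailOffset-odd r)) (trans (red-⊟ j 2+r≤N) (cong (λ z → redAt j (2 + z)) (sym (⌊1+double/2⌋ r))))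
    where
    sum≡ : ∀ r → 2 + r + (2 + r) ≡ 4 + (r + r)
    sum≡ = solve-∀
    2+r≤N : 2 + r ≤ N
    2+r≤N = ≤-trans (s≤s (s≤s (double-≤ (≤-pred q≤lastIndex)))) (≤-trans (n≤1+n (2 + k)) (<⇒≤ n<N))

  redCount-tail : ∀ s j → countℕ (λ q → red (translateLabel s j (4 + q))) (suc lastIndex) ≡ suc k + ⟦ redAt j 2 ⟧
  redCount-tail s j = begin
    countℕ (λ q → red (translateLabel s j (4 + q))) (suc lastIndex)  ≡⟨ countℕ-cong (suc lastIndex) (λ q q≤ → red-tail s j q (≤-pred q≤)) ⟩
    countℕ (λ q → redAt j (2 + ⌊ q /2⌋)) (suc lastIndex)              ≡⟨ cong (λ m → countℕ (λ q → redAt j (2 + ⌊ q /2⌋)) (2 + m)) (sym (+-suc k k)) ⟩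
    countℕ (λ q → redAt j (2 + ⌊ q /2⌋)) (suc (suc k + suc k))        ≡⟨ countℕ-alternating (suc k) (redAt j) (redAt-suc j) 2 ⟩
    suc k + ⟦ redAt j 2 ⟧                                             ∎
    where open ≡-Reasoning

  redAt-special : redAt special 1 ≡ false
  redAt-special = cong not (trans (cong odd (+-comm special 1)) (odd-1+double k))

  -- The special translate is even, so its labels j ± 1 are blue; this compensates for its
  -- second ∞.
  redCount-translate : ∀ s j → (s ≡ true → j ≡ special) → countℕ (λ p → red (translateLabel s j p)) (suc N) ≡ suc n
  redCount-translate false j _ =
    trans (cong₂ _+_ (cong ⟦_⟧ red-N) (cong₂ _+_ (cong ⟦_⟧ (red-⊞ j 1)) (cong₂ _+_ (cong ⟦_⟧ (red-⊟ j (s≤s z≤n)))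
            (cong₂ _+_ (cong ⟦_⟧ (trans (red-⊞ j 2) (redAt-suc j 1))) (trans (redCount-tail false j) (cong (λ b → suc k + ⟦ b ⟧) (redAt-suc j 1)))))))
          (balanced (redAt j 1))
    where
    balanced : ∀ a → 1 + (⟦ a ⟧ + (⟦ a ⟧ + (⟦ not a ⟧ + (suc k + ⟦ not a ⟧)))) ≡ suc n
    balanced true  = cong (4 +_) (+-identityʳ k)
    balanced false = cong (3 +_) (+-comm k 1)
  redCount-translate true j j≡special rewrite j≡special refl =
    trans (cong₂ _+_ (cong ⟦_⟧ red-N) (cong₂ _+_ (cong ⟦_⟧ red-N) (cong₂ _+_ (cong ⟦_⟧ (trans (red-⊞ special 1) redAt-special))
            (cong₂ _+_ (cong ⟦_⟧ (trans (red-⊟ special (s≤s z≤n)) redAt-special))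
              (trans (redCount-tail true special) (cong (λ b → suc k + ⟦ b ⟧) (trans (redAt-suc special 1) (cong not redAt-special))))))))
          (cong (3 +_) (+-comm k 1))

  redCount-walk : ∀ J → J ≤ N → countℕ (λ p → red (label J p)) (suc N) ≡ suc n
  redCount-walk J J≤N with m≤n⇒m<n∨m≡n J≤N
  ... | inj₁ J<N rewrite <N⇒≡ᵇ-false J<N = redCount-translate (J ≡ᵇ special) J ≡ᵇ-true⇒≡
  ... | inj₂ refl rewrite ≡ᵇ-refl N = cong suc (trans (cong (countℕ red) (sym n+n≡N)) (countℕ-even n))

  redCount-part : countℕ red (suc N) ≡ suc n
  redCount-part = cong suc (trans (cong (countℕ (λ i → red (suc i))) (sym n+n≡N)) (countℕ-even-suc n))

EquitableDecomposition : ℕ → Set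
EquitableDecomposition ℓ =
  Σ ℕ λ m → Σ (Fin m → Cycle ℓ ℓ) λ cs → Σ (Vtx ℓ → Bool) λ col →
    IsDecomposition cs ×
    (∀ k → (count true (λ i → col (vtx (cs k) i)) ≡ (ℓ ∸ 1) / 2 ×
            count false (λ i → col (vtx (cs k) i)) ≡ suc ℓ / 2)
         ⊎ (count true (λ i → col (vtx (cs k) i)) ≡ suc ℓ / 2 ×
            count false (λ i → col (vtx (cs k) i)) ≡ (ℓ ∸ 1) / 2)) ×
    (∀ x → count true (λ j → col (x , j)) ≡ suc ℓ / 2 ×
           count false (λ j → col (x , j)) ≡ (ℓ ∸ 1) / 2)

module Equitable (k : ℕ) where
  open Walks k
  open ArcIndexing k using (Indexes; arcIndex-arc; arc-arcIndex)
  open PartSteps k using (part-next)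
  open VertexPositions k using (vertexPosition; vertexPosition-label)
  open Colouring k using (red; redCount-walk; redCount-part)

  L : ℕ
  L = suc N

  ≤N : (i : Fin L) → toℕ i ≤ N
  ≤N i = ≤-pred (toℕ<n i)

  translateLabel-≤ : ∀ s j p → translateLabel s j p ≤ N
  translateLabel-≤ s j 0 = ≤-refl
  translateLabel-≤ true  j 1 = ≤-refl
  translateLabel-≤ false j 1 = ⊞-≤ j 1
  translateLabel-≤ true  j 2 = ⊞-≤ j 1
  translateLabel-≤ false j 2 = ⊞-≤ j (N ∸ 1)
  translateLabel-≤ true  j 3 = ⊞-≤ j (N ∸ 1)
  translateLabel-≤ false j 3 = ⊞-≤ j 2
  translateLabel-≤ s j (suc (suc (suc (suc q)))) = ⊞-≤ j (tailOffset q)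

  label-≤ : ∀ J p → p ≤ N → label J p ≤ N
  label-≤ J p p≤N with J ≡ᵇ N
  ... | true  = ≤-trans (pred-≤ p) p≤N
    where
    pred-≤ : ∀ m → pred m ≤ m
    pred-≤ zero = z≤n
    pred-≤ (suc m) = n≤1+n m
  ... | false = translateLabel-≤ _ J p

  toℕ-next : ∀ (i : Fin L) → toℕ (next i) ≡ nextℕ (toℕ i)
  toℕ-next i with suc (toℕ i) <? suc N
  ... | yes i<N = trans (toℕ-fromℕ< i<N) (sym (nextℕ-< (≤-pred i<N)))
  ... | no i≮N with m≤n⇒m<n∨m≡n (≤N i)
  ...   | inj₁ i<N = ⊥-elim (i≮N (s≤s i<N))
  ...   | inj₂ i≡N = sym (trans (cong nextℕ i≡N) nextℕ-N)

  walks : WalkFamily L L L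
  walks = record
    { label = λ J p → fromℕ< (s≤s (label-≤ (toℕ J) (toℕ p) (≤N p)))
    ; shift = λ J p → part (toℕ J) (toℕ p)
    ; up    = λ J p → up (toℕ J) (toℕ p)
    }

  open WalkFamily walks using () renaming (label to label′; arc to arc′)

  toℕ-label′ : ∀ J p → toℕ (label′ J p) ≡ label (toℕ J) (toℕ p)
  toℕ-label′ J p = toℕ-fromℕ< (s≤s (label-≤ (toℕ J) (toℕ p) (≤N p)))

  toℕ₂ : Fin L × Fin L → ℕ × ℕ
  toℕ₂ (x , y) = toℕ x , toℕ y

  toℕ₂-injective : ∀ {a b} → toℕ₂ a ≡ toℕ₂ b → a ≡ b
  toℕ₂-injective e = cong₂ _,_ (toℕ-injective (cong proj₁ e)) (toℕ-injective (cong proj₂ e))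

  fromIndexes : ∀ {e} i → Indexes e i → Fin L × Fin L
  fromIndexes (J , p) (J≤N , p≤N , _) = fromℕ< (s≤s J≤N) , fromℕ< (s≤s p≤N)

  toℕ₂-fromIndexes : ∀ {e} i (ix : Indexes e i) → toℕ₂ (fromIndexes i ix) ≡ i
  toℕ₂-fromIndexes (J , p) (J≤N , p≤N , _) = cong₂ _,_ (toℕ-fromℕ< (s≤s J≤N)) (toℕ-fromℕ< (s≤s p≤N))

  toℕ₂-arc : ∀ i → toℕ₂ (arc′ i) ≡ arc (toℕ (proj₁ i)) (toℕ (proj₂ i))
  toℕ₂-arc (J , p) with up (toℕ J) (toℕ p)
  ... | true  = cong₂ _,_ (toℕ-fromℕ< _) (trans (toℕ-fromℕ< _) (cong (label (toℕ J)) (toℕ-next p)))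
  ... | false = cong₂ _,_ (trans (toℕ-fromℕ< _) (cong (label (toℕ J)) (toℕ-next p))) (toℕ-fromℕ< _)

  arcIndex′ : Fin L × Fin L → Fin L × Fin L
  arcIndex′ (x , y) = fromIndexes (arcIndexℕ (toℕ x , toℕ y)) (arc-arcIndex (toℕ x) (toℕ y) (≤N x) (≤N y))

  toℕ₂-arcIndex′ : ∀ e → toℕ₂ (arcIndex′ e) ≡ arcIndexℕ (toℕ₂ e)
  toℕ₂-arcIndex′ (x , y) = toℕ₂-fromIndexes _ (arc-arcIndex (toℕ x) (toℕ y) (≤N x) (≤N y))

  decomposing : IsDecomposing walks
  decomposing = record
    { shift-next     = λ J p → trans (cong (part (toℕ J)) (toℕ-next p)) (part-next (toℕ J) (toℕ p) (≤N J) (≤N p))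
    ; lift-injective = λ J {p} {p′} e → toℕ-injective (trans (sym (vertexPosition-label (toℕ J) (toℕ p) (≤N J) (≤N p)))
        (trans (cong₂ (vertexPosition (toℕ J)) (cong proj₁ e) (trans (sym (toℕ-label′ J p)) (trans (cong (λ v → toℕ (proj₂ v)) e) (toℕ-label′ J p′))))
               (vertexPosition-label (toℕ J) (toℕ p′) (≤N J) (≤N p′))))
    ; arcIndex       = arcIndex′
    ; arcIndex-arc   = λ { (J , p) → toℕ₂-injective (trans (toℕ₂-arcIndex′ (arc′ (J , p)))
        (trans (cong arcIndexℕ (toℕ₂-arc (J , p))) (arcIndex-arc (toℕ J) (toℕ p) (≤N J) (≤N p)))) }
    ; arc-arcIndex   = λ { (x , y) → toℕ₂-injective (arc-arcIndex′ x y) }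
    }
    where
    arc-arcIndex′ : ∀ x y → toℕ₂ (arc′ (arcIndex′ (x , y))) ≡ (toℕ x , toℕ y)
    arc-arcIndex′ x y = trans (toℕ₂-arc (arcIndex′ (x , y)))
      (trans (cong (λ i → arc (proj₁ i) (proj₂ i)) (toℕ₂-arcIndex′ (x , y))) (proj₂ (proj₂ ix)))
      where
      ix = arc-arcIndex (toℕ x) (toℕ y) (≤N x) (≤N y)

  open Lift walks decomposing using (cycles; decomposition)

  colour : Vtx L → Bool
  colour (g , x) = red (toℕ x)

  redCount-cycle : ∀ c → count true (λ i → colour (vtx (cycles c) i)) ≡ suc n
  redCount-cycle c = trans (count-cong true (λ i → colour (vtx (cycles c) i)) (λ i → red (label (toℕ walk) (toℕ i))) (λ i → cong red (toℕ-label′ walk i)))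
    (trans (count-toℕ L (λ p → red (label (toℕ walk) p))) (redCount-walk (toℕ walk) (≤N walk)))
    where
    walk = proj₂ (remQuot {3} L c)

  redCount-vertexPart : ∀ g → count true (λ x → colour (g , x)) ≡ suc n
  redCount-vertexPart g = trans (count-toℕ L red) redCount-part

  blueCount : ∀ (f : Fin L → Bool) → count true f ≡ suc n → count false f ≡ n
  blueCount f reds = +-cancelˡ-≡ (suc n) _ _ (trans (cong (_+ count false f) (sym reds))
    (trans (count-true+false f) (cong suc (sym n+n≡N))))

  [L∸1]/2≡n : (L ∸ 1) / 2 ≡ n
  [L∸1]/2≡n = trans (cong (_/ 2) (N≡n*2 k)) (m*n/n≡m n 2)
    where
    N≡n*2 : ∀ k → 6 + (k + k) ≡ (3 + k) * 2
    N≡n*2 = solve-∀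

  [1+L]/2≡1+n : suc L / 2 ≡ suc n
  [1+L]/2≡1+n = trans (cong (_/ 2) (1+L≡[1+n]*2 k)) (m*n/n≡m (suc n) 2)
    where
    1+L≡[1+n]*2 : ∀ k → 8 + (k + k) ≡ (4 + k) * 2
    1+L≡[1+n]*2 = solve-∀

  equitableDecomposition : EquitableDecomposition L
  equitableDecomposition = 3 * L , cycles , colour , decomposition ,
    (λ c → inj₂ (halves (λ i → colour (vtx (cycles c) i)) (redCount-cycle c))) ,
    (λ g → halves (λ x → colour (g , x)) (redCount-vertexPart g))
    where
    halves : ∀ (f : Fin L → Bool) → count true f ≡ suc n → count true f ≡ suc L / 2 × count false f ≡ (L ∸ 1) / 2
    halves f reds = trans reds (sym [1+L]/2≡1+n) , trans (blueCount f reds) (sym [L∸1]/2≡n)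

odd≥7 : ∀ ℓ → 7 ≤ ℓ → ℓ % 2 ≡ 1 → Σ ℕ λ k → ℓ ≡ 7 + (k + k)
odd≥7 ℓ 7≤ℓ ℓ%2≡1 with halving ℓ
... | twice r = ⊥-elim (0≢1+n (trans (sym even%2) ℓ%2≡1))
  where
  even%2 : (r + r) % 2 ≡ 0
  even%2 = trans (cong (λ z → (r + z) % 2) (sym (+-identityʳ r))) (trans (cong (_% 2) (*-comm 2 r)) (m*n%n≡0 r 2))
... | twice+1 r = r ∸ 3 , cong suc (trans (cong (λ z → z + z) (sym r≡)) (double (r ∸ 3)))
  where
  double : ∀ m → 3 + m + (3 + m) ≡ 6 + (m + m)
  double = solve-∀
  r≡ : 3 + (r ∸ 3) ≡ r
  r≡ = m+[n∸m]≡n (1+double-≤ {2} {r} (≤-trans (n≤1+n 5) (≤-pred 7≤ℓ)))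

lemma8 : ∀ (ℓ : ℕ) → 7 ≤ ℓ → ℓ % 2 ≡ 1 →
    Σ ℕ λ m → Σ (Fin m → Cycle ℓ ℓ) λ cs → Σ (Vtx ℓ → Bool) λ col →
      IsDecomposition cs ×
      (∀ k → (count true (λ i → col (vtx (cs k) i)) ≡ (ℓ ∸ 1) / 2 ×
              count false (λ i → col (vtx (cs k) i)) ≡ suc ℓ / 2)
           ⊎ (count true (λ i → col (vtx (cs k) i)) ≡ suc ℓ / 2 ×
              count false (λ i → col (vtx (cs k) i)) ≡ (ℓ ∸ 1) / 2)) ×
      (∀ x → count true (λ j → col (x , j)) ≡ suc ℓ / 2 ×
             count false (λ j → col (x , j)) ≡ (ℓ ∸ 1) / 2)
lemma8 ℓ 7≤ℓ ℓ%2≡1 with odd≥7 ℓ 7≤ℓ ℓ%2≡1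
... | k , refl = Equitable.equitableDecomposition k
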